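{- Let $f_1,f_2$, $M$ and $\mathscr{C}_h$ be as in the context. There is a constant $C>0$ independent of $\ell$ such that for any prime $\ell \ge M$, $$ \left| | \mathscr{C}_{\ell} | -\frac{\ell^6}{\lambda_1}\right| \le C\,\ell^5, \qquad \lambda_1=\gcd(\ell-1,\,k_1-1,\,k_2-1).$$
   Context: Let $f_1 \in S_{k_1}(N_1)$ and $f_2 \in S_{k_2}(N_2)$ be non-CM newforms of weights $k_1,k_2\ge2$ with rational integer Fourier coefficients $a_1(n),a_2(n)$, which are not character twists of each other. For a newform $f\in S_k(N)$ with integer coefficients and a prime $\ell$, let $\rho_{f,\ell}:G_{\mathbb Q}\to \mathrm{GL}_2(\mathbb Z_\ell)$ be the associated $\ell$-adic Galois representation, unramified at $p\nmid N\ell$ with $\mathrm{tr}\,\rho_{f,\ell}(\mathrm{Frob}_p)=a(p)$, $\det\rho_{f,\ell}(\mathrm{Frob}_p)=p^{k-1}$. For $h=\prod_j \ell_j^{n_j}$, let $\bar\rho_{f,h}:G_{\mathbb Q}\to \mathrm{GL}_2(\mathbb Z/h\mathbb Z)$ be obtained by reducing the $\rho_{f,\ell_j}$ modulo $\ell_j^{n_j}$. Let $\mathscr{A}_h$ be the image of $\sigma\mapsto(\bar\rho_{f_1,h}(\sigma),\bar\rho_{f_2,h}(\sigma))$ and $\mathscr{C}_h=\{(A,B)\in\mathscr{A}_h:\mathrm{tr}(A)=\mathrm{tr}(B)\}$. By a theorem of Loeffler there is a constant $M=M(f_1,f_2)\ge 3$ such that for all primes $\ell\ge M$ and all $n\ge1$,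 $\mathscr{A}_{\ell^n}=\{(A, B)\in \mathrm{GL}_2(\mathbb Z/\ell^n\mathbb Z)^2: \det A=v^{k_1 -1},\ \det B= v^{k_2 -1} \text{ for some } v \in (\mathbb Z/\ell^n\mathbb Z)^{\times} \}$; $M$ denotes such a constant. -}

module Defs where

open import Data.Nat as ℕ using (ℕ; zero; suc; _∸_; _^_)
open import Data.Nat.GCD using (gcd)
open import Data.Integer as ℤ using (ℤ; +_; _%ℕ_)
open import Data.Fin using (Fin; toℕ)
open import Data.List using (List; concatMap; map; filterᵇ; length; allFin)
open import Data.Bool using (Bool; true; _∧_)
open import Data.Product using (_×_; _,_; ∃; Σ; proj₁; proj₂)
open import Relation.Binary.PropositionalEquality using (_≡_)
open import Relation.Nullary.Decidable using (⌊_⌋)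
open import Data.Nat.Properties using (_≟_)
open import Data.Rational as ℚ using (ℚ)
open import Function.Bundles using (_⇔_)

-- Residue of an integer modulo ℓ, as a natural number in [0, ℓ)
-- (convention: modulus 0 gives 0; only used for prime ℓ).
_mod_ : ℤ → ℕ → ℕ
x mod zero    = 0
x mod (suc n) = x %ℕ suc n

-- A 2x2 matrix over ℤ/ℓℤ, entries represented by Fin ℓ:
-- (a , b , c , d) stands for [[a , b] , [c , d]].
Mat2 : ℕ → Set
Mat2 ℓ = Fin ℓ × Fin ℓ × Fin ℓ × Fin ℓ

det : {ℓ : ℕ} → Mat2 ℓ → ℕ
det {ℓ} (a , b , c , d) = ((+ (toℕ a ℕ.* toℕ d)) ℤ.- (+ (toℕ b ℕ.* toℕ c))) mod ℓ

tr : {ℓ : ℕ} → Mat2 ℓ → ℕ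
tr {ℓ} (a , b , c , d) = (+ (toℕ a ℕ.+ toℕ d)) mod ℓ

IsUnit : ℕ → ℕ → Set
IsUnit ℓ u = ∃ λ (w : Fin ℓ) → (+ (u ℕ.* toℕ w)) mod ℓ ≡ (+ 1) mod ℓ

-- Loeffler's description of 𝒜_ℓ (level h = ℓ):
-- (A , B) ∈ GL₂(ℤ/ℓ)² with det A = v^(k₁-1), det B = v^(k₂-1) for some unit v.
LoefflerSet : ℕ → ℕ → (ℓ : ℕ) → Mat2 ℓ × Mat2 ℓ → Set
LoefflerSet k₁ k₂ ℓ (A , B) =
  IsUnit ℓ (det A) × IsUnit ℓ (det B) ×
  (∃ λ (v : Fin ℓ) → IsUnit ℓ (toℕ v) ×
     (det A ≡ (+ (toℕ v ^ (k₁ ∸ 1))) mod ℓ) ×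
     (det B ≡ (+ (toℕ v ^ (k₂ ∸ 1))) mod ℓ))

allMat2 : (ℓ : ℕ) → List (Mat2 ℓ)
allMat2 ℓ = concatMap (λ a → concatMap (λ b → concatMap (λ c → map (λ d → (a , b , c , d))
              (allFin ℓ)) (allFin ℓ)) (allFin ℓ)) (allFin ℓ)

allPairs : (ℓ : ℕ) → List (Mat2 ℓ × Mat2 ℓ)
allPairs ℓ = concatMap (λ A → map (λ B → (A , B)) (allMat2 ℓ)) (allMat2 ℓ)

-- A family of subsets 𝒜_ℓ ⊆ GL₂(ℤ/ℓ)², given by characteristic functions.
Family : Set
Family = (ℓ : ℕ) → Mat2 ℓ × Mat2 ℓ → Bool

cardC : Family → ℕ → ℕ
cardC 𝒜 ℓ = length (filterᵇ (λ p → 𝒜 ℓ p ∧ ⌊ tr (proj₁ p) ≟ tr (proj₂ p) ⌋) (allPairs ℓ))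

lambda1 : ℕ → ℕ → ℕ → ℕ
lambda1 ℓ k₁ k₂ = gcd (ℓ ∸ 1) (gcd (k₁ ∸ 1) (k₂ ∸ 1))

ℕ→ℚ : ℕ → ℚ
ℕ→ℚ n = (+ n) ℚ./ 1

-- q / n in ℚ (convention: division by 0 gives 0; only used with n = λ₁ ≥ 1)
divℕ : ℚ → ℕ → ℚ
divℕ q zero    = ℚ.0ℚ
divℕ q (suc n) = q ℚ.* ((+ 1) ℚ./ suc n)

-- For ℓ = p prime, (A , B) lies in Loeffler's set exactly when (det A , det B) lies in the image 𝒢 of
-- v ↦ (v ^ (k₁ - 1) , v ^ (k₂ - 1)) on the units of 𝔽_p. The fibres of this map are translates of
-- {v : v ^ λ₁ = 1}, which has exactly λ₁ elements because λ₁ divides p - 1; hence |𝒢| = (p - 1) / λ₁.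
-- Grouping the pairs by their common trace t gives |𝒞_ℓ| = Σ_t Σ_{(e₁ , e₂) ∈ 𝒢} N(t , e₁) N(t , e₂),
-- where N(t , e) counts the matrices of trace t and determinant e. Solving bc = a (t - a) - e for each a
-- gives p (p - 1) ≤ N(t , e) ≤ p (p - 1) + 2p, since a (t - a) = e has at most two roots. Therefore
-- p⁶ - 3p⁵ ≤ λ₁ |𝒞_ℓ| ≤ p⁶ + p⁵, which is the claim with C = 3.
module Submission where

open import Data.Nat using (ℕ)
open import Relation.Binary.PropositionalEquality using (_≡_)
open import Algebra.Definitions {A = ℕ} _≡_ using (Associative; Commutative; LeftIdentity)
open import Data.Nat.Primality using (Prime)

module RangeSum where
  open import Data.Nat
  open import Data.Nat.Properties
  open import Data.Bool using (Bool; true; false; _∧_; not)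
  open import Data.Product using (_×_; Σ; _,_)
  open import Data.Bool.Properties using (T-≡; ¬-not)
  open import Function using (Equivalence)
  open import Relation.Binary.PropositionalEquality
  open import Algebra.Properties.CommutativeSemigroup +-commutativeSemigroup
    using () renaming (interchange to +-interchange)

  ∑ : ℕ → (ℕ → ℕ) → ℕ
  ∑ zero    f = 0
  ∑ (suc n) f = f 0 + ∑ n (λ i → f (suc i))

  syntax ∑ n (λ i → e) = ∑[ i < n ] e

  𝟙 : Bool → ℕ
  𝟙 true  = 1
  𝟙 false = 0

  δ : ℕ → ℕ → ℕ
  δ i j = 𝟙 (i ≡ᵇ j)

  𝟙-∧ : ∀ a b → 𝟙 (a ∧ b) ≡ 𝟙 a * 𝟙 b
  𝟙-∧ true  b = sym (+-identityʳ (𝟙 b))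
  𝟙-∧ false b = refl

  𝟙-mono : ∀ {a b} → (a ≡ true → b ≡ true) → 𝟙 a ≤ 𝟙 b
  𝟙-mono {false} a⇒b = z≤n
  𝟙-mono {true}  a⇒b rewrite a⇒b refl = s≤s z≤n

  ∧-≡true⁻ : ∀ {a b} → (a ∧ b) ≡ true → a ≡ true × b ≡ true
  ∧-≡true⁻ {true} {true} _ = refl , refl

  ∧-≡true : ∀ {a b} → a ≡ true → b ≡ true → (a ∧ b) ≡ true
  ∧-≡true refl refl = refl

  ≡⇒≡ᵇ-true : ∀ {m n} → m ≡ n → (m ≡ᵇ n) ≡ true
  ≡⇒≡ᵇ-true {m} {n} m≡n = Equivalence.to T-≡ (≡⇒≡ᵇ m n m≡n)

  ≡ᵇ-refl : ∀ m → (m ≡ᵇ m) ≡ true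
  ≡ᵇ-refl m = ≡⇒≡ᵇ-true {m} refl

  ≡ᵇ-true⇒≡ : ∀ m n → (m ≡ᵇ n) ≡ true → m ≡ n
  ≡ᵇ-true⇒≡ m n m≡ᵇn = ≡ᵇ⇒≡ m n (Equivalence.from T-≡ m≡ᵇn)

  ≢⇒≡ᵇ-false : ∀ m n → m ≢ n → (m ≡ᵇ n) ≡ false
  ≢⇒≡ᵇ-false m n m≢n = ¬-not (λ m≡ᵇn → m≢n (≡ᵇ-true⇒≡ m n m≡ᵇn))

  δ-sym : ∀ i j → δ i j ≡ δ j i
  δ-sym zero    zero    = refl
  δ-sym zero    (suc j) = refl
  δ-sym (suc i) zero    = refl
  δ-sym (suc i) (suc j) = δ-sym i j

  ∑-cong : ∀ n {f g : ℕ → ℕ} → (∀ i → i < n → f i ≡ g i) → ∑ n f ≡ ∑ n g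
  ∑-cong zero    f≗g = refl
  ∑-cong (suc n) f≗g =
    cong₂ _+_ (f≗g 0 z<s) (∑-cong n (λ i i<n → f≗g (suc i) (s<s i<n)))

  ∑-mono : ∀ n {f g : ℕ → ℕ} → (∀ i → i < n → f i ≤ g i) → ∑ n f ≤ ∑ n g
  ∑-mono zero    f≤g = z≤n
  ∑-mono (suc n) f≤g =
    +-mono-≤ (f≤g 0 z<s) (∑-mono n (λ i i<n → f≤g (suc i) (s<s i<n)))

  ∑-+ : ∀ n (f g : ℕ → ℕ) → ∑[ i < n ] (f i + g i) ≡ ∑ n f + ∑ n g
  ∑-+ zero    f g = refl
  ∑-+ (suc n) f g = trans (cong (f 0 + g 0 +_) (∑-+ n (λ i → f (suc i)) (λ i → g (suc i))))
                          (+-interchange (f 0) (g 0) _ _)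

  ∑-*ˡ : ∀ n c (f : ℕ → ℕ) → ∑[ i < n ] (c * f i) ≡ c * ∑ n f
  ∑-*ˡ zero    c f = sym (*-zeroʳ c)
  ∑-*ˡ (suc n) c f = trans (cong (c * f 0 +_) (∑-*ˡ n c (λ i → f (suc i))))
                           (sym (*-distribˡ-+ c (f 0) _))

  ∑-*ʳ : ∀ n c (f : ℕ → ℕ) → ∑[ i < n ] (f i * c) ≡ ∑ n f * c
  ∑-*ʳ n c f = trans (∑-cong n (λ i _ → *-comm (f i) c)) (trans (∑-*ˡ n c f) (*-comm c _))

  ∑-const : ∀ n c → ∑[ i < n ] c ≡ n * c
  ∑-const zero    c = refl
  ∑-const (suc n) c = cong (c +_) (∑-const n c)

  ∑-zero : ∀ n {f : ℕ → ℕ} → (∀ i → i < n → f i ≡ 0) → ∑ n f ≡ 0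
  ∑-zero n f≗0 = trans (∑-cong n f≗0) (trans (∑-const n 0) (*-zeroʳ n))

  ∑-swap : ∀ m n (f : ℕ → ℕ → ℕ) → ∑[ i < m ] ∑[ j < n ] f i j ≡ ∑[ j < n ] ∑[ i < m ] f i j
  ∑-swap zero    n f = sym (∑-zero n (λ _ _ → refl))
  ∑-swap (suc m) n f = trans (cong (∑[ j < n ] f 0 j +_) (∑-swap m n (λ i → f (suc i))))
                             (sym (∑-+ n (f 0) (λ j → ∑[ i < m ] f (suc i) j)))

  ∑-δˡ : ∀ n j (f : ℕ → ℕ) → j < n → ∑[ i < n ] (δ i j * f i) ≡ f j
  ∑-δˡ (suc n) zero    f _         = trans (cong (f 0 + 0 +_) (∑-zero n (λ _ _ → refl)))
                                           (trans (+-identityʳ _) (+-identityʳ (f 0)))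
  ∑-δˡ (suc n) (suc j) f (s<s j<n) = ∑-δˡ n j (λ i → f (suc i)) j<n

  ∑-δʳ : ∀ n j (f : ℕ → ℕ) → j < n → ∑[ i < n ] (δ j i * f i) ≡ f j
  ∑-δʳ n j f j<n = trans (∑-cong n (λ i _ → cong (_* f i) (δ-sym j i))) (∑-δˡ n j f j<n)

  ∑-fibres : ∀ m n (g : ℕ → ℕ) (f : ℕ → ℕ) → (∀ i → i < m → g i < n) →
    ∑[ i < m ] f i ≡ ∑[ w < n ] ∑[ i < m ] (δ (g i) w * f i)
  ∑-fibres m n g f g<n = begin
    ∑[ i < m ] f i
      ≡⟨ ∑-cong m (λ i i<m → sym (∑-δʳ n (g i) (λ _ → f i) (g<n i i<m))) ⟩
    ∑[ i < m ] ∑[ w < n ] (δ (g i) w * f i)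
      ≡⟨ ∑-swap m n (λ i w → δ (g i) w * f i) ⟩
    ∑[ w < n ] ∑[ i < m ] (δ (g i) w * f i) ∎
    where open ≡-Reasoning

  record SupportBijection (m : ℕ) (P : ℕ → Bool) (n : ℕ) (Q : ℕ → Bool) (h : ℕ → ℕ) : Set where
    field
      maps-to    : ∀ i → i < m → P i ≡ true → h i < n × Q (h i) ≡ true
      injective  : ∀ i j → i < m → j < m → P i ≡ true → P j ≡ true → h i ≡ h j → i ≡ j
      surjective : ∀ j → j < n → Q j ≡ true → Σ ℕ λ i → i < m × P i ≡ true × h i ≡ j

  module _ {n : ℕ} {P Q : ℕ → Bool} {h : ℕ → ℕ} where

    SupportBijection-empty : SupportBijection zero P n Q h → ∀ j → j < n → Q j ≡ false
    SupportBijection-empty bij j j<n with Q j in Qj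
    ... | false = refl
    ... | true with SupportBijection.surjective bij j j<n Qj
    ...   | _ , () , _

    SupportBijection-skip : ∀ {m} → P 0 ≡ false → SupportBijection (suc m) P n Q h →
      SupportBijection m (λ i → P (suc i)) n Q (λ i → h (suc i))
    SupportBijection-skip {m} P0≡false bij = record
      { maps-to    = λ i i<m → maps-to (suc i) (s<s i<m)
      ; injective  = λ i j i<m j<m Pi Pj hi≡hj → suc-injective (injective (suc i) (suc j) (s<s i<m) (s<s j<m) Pi Pj hi≡hj)
      ; surjective = preimage
      }
      where
      open SupportBijection bij
      preimage : ∀ j → j < n → Q j ≡ true → Σ ℕ λ i → i < m × P (suc i) ≡ true × h (suc i) ≡ j
      preimage j j<n Qj with surjective j j<n Qj
      ... | zero  , _ , P0≡true , _ with trans (sym P0≡false) P0≡true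
      ...   | ()
      preimage j j<n Qj | suc i , s<s i<m , Pi , hi≡j = i , i<m , Pi , hi≡j

    SupportBijection-remove : ∀ {m} → P 0 ≡ true → SupportBijection (suc m) P n Q h →
      SupportBijection m (λ i → P (suc i)) n (λ j → Q j ∧ not (j ≡ᵇ h 0)) (λ i → h (suc i))
    SupportBijection-remove {m} P0≡true bij = record
      { maps-to    = image
      ; injective  = λ i j i<m j<m Pi Pj hi≡hj → suc-injective (injective (suc i) (suc j) (s<s i<m) (s<s j<m) Pi Pj hi≡hj)
      ; surjective = preimage
      }
      where
      open SupportBijection bij
      distinct : ∀ i → i < m → P (suc i) ≡ true → h (suc i) ≢ h 0
      distinct i i<m Pi hi≡h0 = 0≢1+n (sym (injective (suc i) 0 (s<s i<m) z<s Pi P0≡true hi≡h0))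
      image : ∀ i → i < m → P (suc i) ≡ true → h (suc i) < n × (Q (h (suc i)) ∧ not (h (suc i) ≡ᵇ h 0)) ≡ true
      image i i<m Pi with maps-to (suc i) (s<s i<m) Pi
      ... | hi<n , Qhi rewrite Qhi | ≢⇒≡ᵇ-false (h (suc i)) (h 0) (distinct i i<m Pi) = hi<n , refl
      preimage : ∀ j → j < n → (Q j ∧ not (j ≡ᵇ h 0)) ≡ true → Σ ℕ λ i → i < m × P (suc i) ≡ true × h (suc i) ≡ j
      preimage j j<n Q′j with Q j in Qj | j ≡ᵇ h 0 in j≡ᵇh0
      preimage j j<n () | false | _
      preimage j j<n () | true  | true
      ... | true | false with surjective j j<n Qj
      ...   | zero  , _ , _ , refl with trans (sym (≡ᵇ-refl (h 0))) j≡ᵇh0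
      ...     | ()
      preimage j j<n Q′j | true | false | suc i , s<s i<m , Pi , hi≡j = i , i<m , Pi , hi≡j

module BigOperator (_⊕_ : ℕ → ℕ → ℕ) (ε : ℕ)
  (⊕-assoc : Associative _⊕_) (⊕-comm : Commutative _⊕_) (⊕-identityˡ : LeftIdentity ε _⊕_) where
  open import Data.Nat
  open import Data.Bool using (Bool; true; false; _∧_; not; if_then_else_)
  open import Data.Bool.Properties using (∧-identityʳ)
  open import Data.Product using (_×_; proj₁; proj₂)
  open import Relation.Binary.PropositionalEquality
  open RangeSum using (SupportBijection; SupportBijection-empty; SupportBijection-skip; SupportBijection-remove)

  ⨁ : ℕ → (ℕ → Bool) → (ℕ → ℕ) → ℕ
  ⨁ zero    P f = ε
  ⨁ (suc n) P f = (if P 0 then f 0 else ε) ⊕ ⨁ n (λ i → P (suc i)) (λ i → f (suc i))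

  ⨁-cong : ∀ n {P Q : ℕ → Bool} {f g : ℕ → ℕ} → (∀ i → i < n → P i ≡ Q i) →
           (∀ i → i < n → P i ≡ true → f i ≡ g i) → ⨁ n P f ≡ ⨁ n Q g
  ⨁-cong zero    P≗Q f≗g = refl
  ⨁-cong (suc n) {P} {Q} P≗Q f≗g =
    cong₂ _⊕_ (head (P 0) (Q 0) (P≗Q 0 z<s) (f≗g 0 z<s))
      (⨁-cong n (λ i i<n → P≗Q (suc i) (s<s i<n)) (λ i i<n → f≗g (suc i) (s<s i<n)))
    where
    head : ∀ {x y : ℕ} a b → a ≡ b → (a ≡ true → x ≡ y) → (if a then x else ε) ≡ (if b then y else ε)
    head true  .true  refl x≡y = x≡y refl
    head false .false refl _   = refl

  ⨁-empty : ∀ n (P : ℕ → Bool) f → (∀ i → i < n → P i ≡ false) → ⨁ n P f ≡ ε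
  ⨁-empty zero    P f P≗false = refl
  ⨁-empty (suc n) P f P≗false rewrite P≗false 0 z<s =
    trans (⊕-identityˡ _) (⨁-empty n (λ i → P (suc i)) (λ i → f (suc i)) (λ i i<n → P≗false (suc i) (s<s i<n)))

  ⨁-extract : ∀ n (P : ℕ → Bool) f j → j < n → P j ≡ true →
    ⨁ n P f ≡ f j ⊕ ⨁ n (λ i → P i ∧ not (i ≡ᵇ j)) f
  ⨁-extract (suc n) P f zero _ Pj rewrite Pj =
    cong (f 0 ⊕_) (trans (⨁-cong n (λ i _ → sym (∧-identityʳ (P (suc i)))) (λ _ _ _ → refl))
                         (sym (⊕-identityˡ _)))
  ⨁-extract (suc n) P f (suc j) (s<s j<n) Pj
    rewrite ⨁-extract n (λ i → P (suc i)) (λ i → f (suc i)) j j<n Pj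
          | ∧-identityʳ (P 0) = ⊕-left-comm _ _ _
    where
    ⊕-left-comm : ∀ a b c → a ⊕ (b ⊕ c) ≡ b ⊕ (a ⊕ c)
    ⊕-left-comm a b c = trans (sym (⊕-assoc a b c)) (trans (cong (_⊕ c) (⊕-comm a b)) (⊕-assoc b a c))

  ⨁-reindex : ∀ m n {P Q : ℕ → Bool} {h : ℕ → ℕ} (f : ℕ → ℕ) →
    SupportBijection m P n Q h → ⨁ m P (λ i → f (h i)) ≡ ⨁ n Q f
  ⨁-reindex zero n {Q = Q} f bij = sym (⨁-empty n Q f (SupportBijection-empty bij))
  ⨁-reindex (suc m) n {P} {Q} {h} f bij with P 0 in P0
  ... | false = trans (⊕-identityˡ _) (⨁-reindex m n f (SupportBijection-skip P0 bij))
  ... | true  = trans (cong (f (h 0) ⊕_) (⨁-reindex m n f (SupportBijection-remove P0 bij)))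
                      (sym (⨁-extract n Q f (h 0) (proj₁ h0∈Q) (proj₂ h0∈Q)))
    where
    h0∈Q : h 0 < n × Q (h 0) ≡ true
    h0∈Q = SupportBijection.maps-to bij 0 z<s P0

-- The modulus is p = n + 1; the parameter is n = p - 1, the number of units, which every count below involves.
module Congruence (n : ℕ) where
  open import Data.Nat as ℕ using (suc; _<_; _≤_)
  import Data.Nat.Properties as ℕ
  import Data.Nat.Divisibility as ℕ
  open import Data.Integer hiding (suc; _<_; _≤_)
  open import Data.Integer.Properties
  open import Data.Integer.DivMod using (a≡a%ℕn+[a/ℕn]*n; n%ℕd<d)
  open import Data.Integer.Divisibility.Signed
  open import Data.Integer.Tactic.RingSolver using (solve-∀)
  open import Data.Sum using (inj₁; inj₂)
  open import Data.Empty using (⊥-elim)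
  open import Function using (_⇔_; mk⇔)
  open import Relation.Binary.PropositionalEquality
  open import Relation.Binary.Structures using (IsEquivalence)
  open import Relation.Binary.Bundles using (Setoid)
  import Relation.Binary.Reasoning.Setoid as SetoidReasoning

  p : ℕ
  p = suc n

  P : ℤ
  P = + p

  infix 4 _≈_
  -- A record rather than a definition, so that x and y can be inferred from a proof of x ≈ y.
  record _≈_ (x y : ℤ) : Set where
    constructor ≈-intro
    field ∣-difference : P ∣ x - y
  open _≈_ public

  ⟦_⟧ : ℤ → ℕ
  ⟦ x ⟧ = x %ℕ p

  ≈-via : ∀ {x y a} → a ≡ x - y → P ∣ a → x ≈ y
  ≈-via a≡x-y P∣a = ≈-intro (subst (P ∣_) a≡x-y P∣a)

  ≈-reflexive : ∀ {x y} → x ≡ y → x ≈ y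
  ≈-reflexive {x} refl = ≈-intro (divides 0ℤ (+-inverseʳ x))

  ≈-refl : ∀ {x} → x ≈ x
  ≈-refl = ≈-reflexive refl

  ≈-sym : ∀ {x y} → x ≈ y → y ≈ x
  ≈-sym {x} {y} (≈-intro x≈y) = ≈-via (swap x y) (∣m⇒∣-m x≈y)
    where
    swap : ∀ x y → - (x - y) ≡ y - x
    swap = solve-∀

  ≈-trans : ∀ {x y z} → x ≈ y → y ≈ z → x ≈ z
  ≈-trans {x} {y} {z} (≈-intro x≈y) (≈-intro y≈z) = ≈-via (telescope x y z) (∣m∣n⇒∣m+n x≈y y≈z)
    where
    telescope : ∀ x y z → (x - y) + (y - z) ≡ x - z
    telescope = solve-∀

  ≈-isEquivalence : IsEquivalence _≈_
  ≈-isEquivalence = record { refl = ≈-refl ; sym = ≈-sym ; trans = ≈-trans }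

  ≈-setoid : Setoid _ _
  ≈-setoid = record { isEquivalence = ≈-isEquivalence }

  module ≈-Reasoning = SetoidReasoning ≈-setoid

  ≈-+ : ∀ {x y x′ y′} → x ≈ x′ → y ≈ y′ → x + y ≈ x′ + y′
  ≈-+ {x} {y} {x′} {y′} (≈-intro x≈x′) (≈-intro y≈y′) = ≈-via (regroup x y x′ y′) (∣m∣n⇒∣m+n x≈x′ y≈y′)
    where
    regroup : ∀ x y x′ y′ → (x - x′) + (y - y′) ≡ (x + y) - (x′ + y′)
    regroup = solve-∀

  ≈-neg : ∀ {x y} → x ≈ y → - x ≈ - y
  ≈-neg {x} {y} (≈-intro x≈y) = ≈-via (neg-minus x y) (∣m⇒∣-m x≈y)
    where
    neg-minus : ∀ x y → - (x - y) ≡ (- x) - (- y)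
    neg-minus = solve-∀

  ≈-minus : ∀ {x y x′ y′} → x ≈ x′ → y ≈ y′ → x - y ≈ x′ - y′
  ≈-minus x≈x′ y≈y′ = ≈-+ x≈x′ (≈-neg y≈y′)

  ≈-* : ∀ {x y x′ y′} → x ≈ x′ → y ≈ y′ → x * y ≈ x′ * y′
  ≈-* {x} {y} {x′} {y′} (≈-intro x≈x′) (≈-intro y≈y′) =
    ≈-via (product-difference x y x′ y′) (∣m∣n⇒∣m+n (∣n⇒∣m*n x y≈y′) (∣m⇒∣m*n y′ x≈x′))
    where
    product-difference : ∀ x y x′ y′ → x * (y - y′) + (x - x′) * y′ ≡ x * y - x′ * y′
    product-difference = solve-∀

  ≈-^ : ∀ {x y} k → x ≈ y → x ^ k ≈ y ^ k
  ≈-^ ℕ.zero    x≈y = ≈-refl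
  ≈-^ (ℕ.suc k) x≈y = ≈-* x≈y (≈-^ k x≈y)

  x≈y⇒x-y≈0 : ∀ {x y} → x ≈ y → x - y ≈ 0ℤ
  x≈y⇒x-y≈0 {x} {y} (≈-intro P∣x-y) = ≈-via (sym (+-identityʳ (x - y))) P∣x-y

  x-y≈0⇒x≈y : ∀ {x y} → x - y ≈ 0ℤ → x ≈ y
  x-y≈0⇒x≈y {x} {y} (≈-intro P∣x-y-0) = ≈-via (+-identityʳ (x - y)) P∣x-y-0

  ≈0⇔∣ : ∀ {x} → x ≈ 0ℤ ⇔ P ∣ x
  ≈0⇔∣ {x} = mk⇔ (λ (≈-intro P∣x-0) → subst (P ∣_) (+-identityʳ x) P∣x-0) (≈-via (sym (+-identityʳ x)))

  ⟦⟧<p : ∀ x → ⟦ x ⟧ < p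
  ⟦⟧<p x = n%ℕd<d x p

  ≈⟦⟧ : ∀ x → x ≈ + ⟦ x ⟧
  ≈⟦⟧ x = ≈-intro (divides (x /ℕ p) (begin
    x - + ⟦ x ⟧                     ≡⟨ cong (_- + ⟦ x ⟧) (a≡a%ℕn+[a/ℕn]*n x p) ⟩
    + ⟦ x ⟧ + x /ℕ p * P - + ⟦ x ⟧ ≡⟨ cancel (+ ⟦ x ⟧) (x /ℕ p * P) ⟩
    x /ℕ p * P                      ∎))
    where
    open ≡-Reasoning
    cancel : ∀ r q → r + q - r ≡ q
    cancel = solve-∀

  private
    ordered-residues-equal : ∀ {r s} → s ≤ r → r < p → + r ≈ + s → r ≡ s
    ordered-residues-equal {r} {s} s≤r r<p r≈s
      with ∣⇒∣ᵤ (subst (P ∣_) (trans (m-n≡m⊖n r s) (⊖-≥ s≤r)) (∣-difference r≈s))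
    ... | ℕ.divides ℕ.zero    r∸s≡0  = ℕ.≤-antisym (ℕ.m∸n≡0⇒m≤n r∸s≡0) s≤r
    ... | ℕ.divides (ℕ.suc q) r∸s≡pq = ⊥-elim (ℕ.<⇒≱ r<p (begin
      p             ≤⟨ ℕ.m≤m+n p (q ℕ.* p) ⟩
      suc q ℕ.* p   ≡⟨ r∸s≡pq ⟨
      r ℕ.∸ s       ≤⟨ ℕ.m∸n≤m r s ⟩
      r             ∎))
      where open ℕ.≤-Reasoning

  residue-injective : ∀ {r s} → r < p → s < p → + r ≈ + s → r ≡ s
  residue-injective {r} {s} r<p s<p r≈s with ℕ.≤-total s r
  ... | inj₁ s≤r = ordered-residues-equal s≤r r<p r≈s
  ... | inj₂ r≤s = sym (ordered-residues-equal r≤s s<p (≈-sym r≈s))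

  ⟦⟧-residue : ∀ {r} → r < p → ⟦ + r ⟧ ≡ r
  ⟦⟧-residue {r} r<p = residue-injective (⟦⟧<p (+ r)) r<p (≈-sym (≈⟦⟧ (+ r)))

  ≈⇒⟦⟧≡ : ∀ {x y} → x ≈ y → ⟦ x ⟧ ≡ ⟦ y ⟧
  ≈⇒⟦⟧≡ {x} {y} x≈y =
    residue-injective (⟦⟧<p x) (⟦⟧<p y) (≈-trans (≈-sym (≈⟦⟧ x)) (≈-trans x≈y (≈⟦⟧ y)))

  ⟦⟧≡⇒≈ : ∀ {x y} → ⟦ x ⟧ ≡ ⟦ y ⟧ → x ≈ y
  ⟦⟧≡⇒≈ {x} {y} ⟦x⟧≡⟦y⟧ = ≈-trans (≈⟦⟧ x) (≈-trans (≈-reflexive (cong +_ ⟦x⟧≡⟦y⟧)) (≈-sym (≈⟦⟧ y)))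

module PrimeField (n : ℕ) (prime : Prime (ℕ.suc n)) where
  open import Data.Nat as ℕ using (suc; zero; _<_; s≤s; z≤n)
  import Data.Nat.Properties as ℕ
  open import Data.Nat.Primality using (euclidsLemma; prime⇒nonTrivial)
  import Data.Nat.Divisibility as ℕ
  open import Data.Nat.Coprimality using (prime⇒coprime; coprime-Bézout)
  open import Data.Nat.GCD using (module Bézout)
  open import Data.Integer hiding (suc; _<_)
  open import Data.Integer.Properties
  open import Data.Integer.Divisibility.Signed using (_∣_; divides; ∣⇒∣ᵤ; ∣ᵤ⇒∣)
  open import Data.Integer.Tactic.RingSolver using (solve-∀)
  open import Data.Product using (Σ; _,_)
  open import Data.Sum using (_⊎_; inj₁; inj₂; [_,_]′)
  open import Data.Empty using (⊥-elim)
  open import Function using (Equivalence; case_of_)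
  open import Relation.Binary.PropositionalEquality
  open import Relation.Nullary using (¬_)
  open Congruence n public

  infix 4 _≉_
  _≉_ : ℤ → ℤ → Set
  x ≉ y = ¬ x ≈ y

  x*y≈0⇒x≈0∨y≈0 : ∀ x y → x * y ≈ 0ℤ → x ≈ 0ℤ ⊎ y ≈ 0ℤ
  x*y≈0⇒x≈0∨y≈0 x y xy≈0
    with euclidsLemma ∣ x ∣ ∣ y ∣ prime (subst (p ℕ.∣_) (abs-* x y) (∣⇒∣ᵤ (Equivalence.to ≈0⇔∣ xy≈0)))
  ... | inj₁ p∣x = inj₁ (Equivalence.from ≈0⇔∣ (∣ᵤ⇒∣ p∣x))
  ... | inj₂ p∣y = inj₂ (Equivalence.from ≈0⇔∣ (∣ᵤ⇒∣ p∣y))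

  *-≉0 : ∀ {x y} → x ≉ 0ℤ → y ≉ 0ℤ → x * y ≉ 0ℤ
  *-≉0 {x} {y} x≉0 y≉0 xy≈0 with x*y≈0⇒x≈0∨y≈0 x y xy≈0
  ... | inj₁ x≈0 = x≉0 x≈0
  ... | inj₂ y≈0 = y≉0 y≈0

  *-cancelˡ-≈ : ∀ {x y z} → x ≉ 0ℤ → x * y ≈ x * z → y ≈ z
  *-cancelˡ-≈ {x} {y} {z} x≉0 xy≈xz =
    [ (λ x≈0 → ⊥-elim (x≉0 x≈0)) , x-y≈0⇒x≈y ]′ (x*y≈0⇒x≈0∨y≈0 x (y - z) x[y-z]≈0)
    where
    *-distribˡ-minus : ∀ x y z → x * (y - z) ≡ x * y - x * z
    *-distribˡ-minus = solve-∀
    x[y-z]≈0 : x * (y - z) ≈ 0ℤ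
    x[y-z]≈0 = ≈-trans (≈-reflexive (*-distribˡ-minus x y z)) (x≈y⇒x-y≈0 xy≈xz)

  1<p : 1 ℕ.< p
  1<p = ℕ.nonTrivial⇒n>1 p {{prime⇒nonTrivial prime}}

  1≉0 : 1ℤ ≉ 0ℤ
  1≉0 1≈0 = case residue-injective 1<p (s≤s z≤n) 1≈0 of λ ()

  ^-≉0 : ∀ {x} k → x ≉ 0ℤ → x ^ k ≉ 0ℤ
  ^-≉0 zero    x≉0 = 1≉0
  ^-≉0 (suc k) x≉0 = *-≉0 x≉0 (^-≉0 k x≉0)

  residue≢0⇒≉0 : ∀ {r} → r < p → r ≢ 0 → + r ≉ 0ℤ
  residue≢0⇒≉0 r<p r≢0 r≈0 = r≢0 (residue-injective r<p (s≤s z≤n) r≈0)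

  ≉0⇒⟦⟧≢0 : ∀ {x} → x ≉ 0ℤ → ⟦ x ⟧ ≢ 0
  ≉0⇒⟦⟧≢0 {x} x≉0 ⟦x⟧≡0 = x≉0 (≈-trans (≈⟦⟧ x) (≈-reflexive (cong +_ ⟦x⟧≡0)))

  private
    pos-Bézout : ∀ a b c d → 1 ℕ.+ a ℕ.* b ≡ c ℕ.* d → 1ℤ + + a * + b ≡ + c * + d
    pos-Bézout a b c d e = begin
      1ℤ + + a * + b    ≡⟨ cong (λ z → 1ℤ + z) (pos-* a b) ⟨
      + (1 ℕ.+ a ℕ.* b) ≡⟨ cong +_ e ⟩
      + (c ℕ.* d)       ≡⟨ pos-* c d ⟩
      + c * + d         ∎
      where open ≡-Reasoning

  inverse-residue : ∀ {r} → r < p → r ≢ 0 → Σ ℤ λ y → + r * y ≈ 1ℤ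
  inverse-residue {zero}          _   r≢0 = ⊥-elim (r≢0 refl)
  inverse-residue {r@(suc _)} r<p _ with coprime-Bézout (prime⇒coprime prime r<p)
  ... | Bézout.+- a b 1+br≡ap =
    - + b , ≈-via (lhs (+ r) (+ b) (+ a) (pos-Bézout b r a p 1+br≡ap)) (divides (- + a) refl)
    where
    lhs : ∀ r b a → 1ℤ + b * r ≡ a * P → - a * P ≡ r * - b - 1ℤ
    lhs r b a e = trans (sym (neg-distribˡ-* a P)) (trans (cong -_ (sym e)) (reorder r b))
      where
      reorder : ∀ r b → - (1ℤ + b * r) ≡ r * - b - 1ℤ
      reorder = solve-∀
  ... | Bézout.-+ a b 1+ap≡br =
    + b , ≈-via (lhs (+ r) (+ b) (+ a) (pos-Bézout a p b r 1+ap≡br)) (divides (+ a) refl)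
    where
    lhs : ∀ r b a → 1ℤ + a * P ≡ b * r → a * P ≡ r * b - 1ℤ
    lhs r b a e = trans (sym (cancel (a * P))) (trans (cong (_- 1ℤ) e) (cong (_- 1ℤ) (*-comm b r)))
      where
      cancel : ∀ z → 1ℤ + z - 1ℤ ≡ z
      cancel = solve-∀

  inverse : ∀ {x} → x ≉ 0ℤ → Σ ℤ λ y → x * y ≈ 1ℤ
  inverse {x} x≉0 with inverse-residue (⟦⟧<p x) (≉0⇒⟦⟧≢0 x≉0)
  ... | y , ⟦x⟧y≈1 = y , ≈-trans (≈-* (≈⟦⟧ x) ≈-refl) ⟦x⟧y≈1

module Fermat (n : ℕ) (prime : Prime (ℕ.suc n)) where
  open import Data.Nat as ℕ using (suc; zero; _<_; _≡ᵇ_; z<s; s<s)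
  import Data.Nat.Properties as ℕ
  open import Data.Integer hiding (suc; _<_)
  open import Data.Integer.Properties
  open import Data.Integer.Tactic.RingSolver using (solve-∀)
  open import Data.Bool using (Bool; true; false; not)
  open import Data.Product using (_×_; _,_; proj₁; proj₂)
  open import Data.Empty using (⊥-elim)
  open import Relation.Binary.PropositionalEquality
  open RangeSum
  open PrimeField n prime
  open BigOperator ℕ._*_ 1 ℕ.*-assoc ℕ.*-comm ℕ.*-identityˡ renaming (⨁ to ∏; ⨁-reindex to ∏-reindex)

  nonZeroᵇ : ℕ → Bool
  nonZeroᵇ x = not (x ≡ᵇ 0)

  nonZeroᵇ-intro : ∀ {x} → x ≢ 0 → nonZeroᵇ x ≡ true
  nonZeroᵇ-intro {zero}  x≢0 = ⊥-elim (x≢0 refl)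
  nonZeroᵇ-intro {suc x} _   = refl

  nonZeroᵇ-elim : ∀ {x} → nonZeroᵇ x ≡ true → x ≢ 0
  nonZeroᵇ-elim {suc x} _ ()

  count-nonZero : ∑[ i < suc n ] 𝟙 (nonZeroᵇ i) ≡ n
  count-nonZero = trans (∑-const n 1) (ℕ.*-identityʳ n)

  ∏-≉0 : ∀ m (Q : ℕ → Bool) g → (∀ i → i < m → Q i ≡ true → g i < p × g i ≢ 0) → + ∏ m Q g ≉ 0ℤ
  ∏-≉0 zero    Q g _ = 1≉0
  ∏-≉0 (suc m) Q g g-unit with Q 0 in Q0
  ... | true  = λ prod≈0 → *-≉0 (residue≢0⇒≉0 (proj₁ g0-unit) (proj₂ g0-unit)) rest≉0
                             (≈-trans (≈-reflexive (sym (pos-* (g 0) _))) prod≈0)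
    where
    g0-unit : g 0 < p × g 0 ≢ 0
    g0-unit = g-unit 0 z<s Q0
    rest≉0 : + ∏ m (λ i → Q (suc i)) (λ i → g (suc i)) ≉ 0ℤ
    rest≉0 = ∏-≉0 m (λ i → Q (suc i)) (λ i → g (suc i)) (λ i i<m → g-unit (suc i) (s<s i<m))
  ... | false = λ prod≈0 → ∏-≉0 m (λ i → Q (suc i)) (λ i → g (suc i)) (λ i i<m → g-unit (suc i) (s<s i<m))
                             (≈-trans (≈-reflexive (cong +_ (sym (ℕ.*-identityˡ _)))) prod≈0)

  ∏-scale : ∀ a m (Q : ℕ → Bool) g →
    + ∏ m Q (λ i → ⟦ a * + g i ⟧) ≈ a ^ (∑[ i < m ] 𝟙 (Q i)) * + ∏ m Q g
  ∏-scale a zero    Q g = ≈-refl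
  ∏-scale a (suc m) Q g with Q 0 | ∏-scale a m (λ i → Q (suc i)) (λ i → g (suc i))
  ... | true  | ih = begin
    + (⟦ a * + g 0 ⟧ ℕ.* ∏′)             ≡⟨ pos-* ⟦ a * + g 0 ⟧ ∏′ ⟩
    + ⟦ a * + g 0 ⟧ * + ∏′               ≈⟨ ≈-* (≈-sym (≈⟦⟧ (a * + g 0))) ih ⟩
    a * + g 0 * (a ^ s * + ∏g)           ≡⟨ interchange a (+ g 0) (a ^ s) (+ ∏g) ⟩
    a * a ^ s * (+ g 0 * + ∏g)           ≡⟨ cong (a * a ^ s *_) (pos-* (g 0) ∏g) ⟨
    a * a ^ s * + (g 0 ℕ.* ∏g)           ∎
    where
    open ≈-Reasoning
    ∏′ ∏g s : ℕ
    ∏′ = ∏ m (λ i → Q (suc i)) (λ i → ⟦ a * + g (suc i) ⟧)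
    ∏g = ∏ m (λ i → Q (suc i)) (λ i → g (suc i))
    s  = ∑[ i < m ] 𝟙 (Q (suc i))
    interchange : ∀ a g b c → a * g * (b * c) ≡ a * b * (g * c)
    interchange = solve-∀
  ... | false | ih = begin
    + (1 ℕ.* ∏′)                         ≡⟨ cong +_ (ℕ.*-identityˡ ∏′) ⟩
    + ∏′                                 ≈⟨ ih ⟩
    a ^ s * + ∏g                         ≡⟨ cong (λ z → a ^ s * + z) (ℕ.*-identityˡ ∏g) ⟨
    a ^ s * + (1 ℕ.* ∏g)                 ∎
    where
    open ≈-Reasoning
    ∏′ ∏g s : ℕ
    ∏′ = ∏ m (λ i → Q (suc i)) (λ i → ⟦ a * + g (suc i) ⟧)
    ∏g = ∏ m (λ i → Q (suc i)) (λ i → g (suc i))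
    s  = ∑[ i < m ] 𝟙 (Q (suc i))

  unit-multiplication-bijection : ∀ {a} → a ≉ 0ℤ →
    SupportBijection p nonZeroᵇ p nonZeroᵇ (λ i → ⟦ a * + i ⟧)
  unit-multiplication-bijection {a} a≉0 = record
    { maps-to    = λ i i<p i≢0 → ⟦⟧<p (a * + i) , nonZeroᵇ-intro (≉0⇒⟦⟧≢0 (ai≉0 i<p i≢0))
    ; injective  = λ i j i<p j<p _ _ ai≡aj →
        residue-injective i<p j<p (*-cancelˡ-≈ a≉0 (⟦⟧≡⇒≈ ai≡aj))
    ; surjective = λ j j<p j≢0 →
        ⟦ b * + j ⟧ , ⟦⟧<p (b * + j) , nonZeroᵇ-intro (≉0⇒⟦⟧≢0 (bj≉0 j<p j≢0)) ,
        trans (≈⇒⟦⟧≡ (≈-trans (≈-* (≈-refl {a}) (≈-sym (≈⟦⟧ (b * + j)))) (a[bj]≈j j))) (⟦⟧-residue j<p)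
    }
    where
    b : ℤ
    b = proj₁ (inverse a≉0)
    ab≈1 : a * b ≈ 1ℤ
    ab≈1 = proj₂ (inverse a≉0)
    ai≉0 : ∀ {i} → i < p → nonZeroᵇ i ≡ true → a * + i ≉ 0ℤ
    ai≉0 i<p i≢0 = *-≉0 a≉0 (residue≢0⇒≉0 i<p (nonZeroᵇ-elim i≢0))
    a[bj]≈j : ∀ j → a * (b * + j) ≈ + j
    a[bj]≈j j = begin
      a * (b * + j) ≡⟨ *-assoc a b (+ j) ⟨
      a * b * + j   ≈⟨ ≈-* ab≈1 ≈-refl ⟩
      1ℤ * + j      ≡⟨ *-identityˡ (+ j) ⟩
      + j           ∎
      where open ≈-Reasoning
    bj≉0 : ∀ {j} → j < p → nonZeroᵇ j ≡ true → b * + j ≉ 0ℤ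
    bj≉0 {j} j<p j≢0 bj≈0 = residue≢0⇒≉0 j<p (nonZeroᵇ-elim j≢0)
      (≈-trans (≈-sym (a[bj]≈j j)) (≈-trans (≈-* (≈-refl {a}) bj≈0) (≈-reflexive (*-zeroʳ a))))

  fermat : ∀ {a} → a ≉ 0ℤ → a ^ n ≈ 1ℤ
  fermat {a} a≉0 = *-cancelˡ-≈ X≉0 (begin
    X * a ^ n   ≡⟨ *-comm X (a ^ n) ⟩
    a ^ n * X   ≈⟨ ≈-sym X≈aⁿX ⟩
    X           ≡⟨ *-identityʳ X ⟨
    X * 1ℤ      ∎)
    where
    open ≈-Reasoning
    X : ℤ
    X = + ∏ p nonZeroᵇ (λ i → i)
    X≉0 : X ≉ 0ℤ
    X≉0 = ∏-≉0 p nonZeroᵇ (λ i → i) (λ i i<p i≢0 → i<p , nonZeroᵇ-elim i≢0)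
    X≈aⁿX : X ≈ a ^ n * X
    X≈aⁿX = begin
      X                                        ≡⟨ cong +_ (∏-reindex p p (λ i → i) (unit-multiplication-bijection a≉0)) ⟨
      + ∏ p nonZeroᵇ (λ i → ⟦ a * + i ⟧)      ≈⟨ ∏-scale a p nonZeroᵇ (λ i → i) ⟩
      a ^ (∑[ i < p ] 𝟙 (nonZeroᵇ i)) * X     ≡⟨ cong (λ k → a ^ k * X) count-nonZero ⟩
      a ^ n * X                                ∎

module Polynomial where
  open import Data.Nat using (suc; zero)
  open import Data.Integer hiding (suc)
  open import Data.Integer.Properties
  open import Data.Integer.Tactic.RingSolver using (solve-∀)
  open import Data.Product using (Σ; _×_; _,_)
  open import Relation.Binary.PropositionalEquality

  data Poly≤ : ℕ → (ℤ → ℤ) → Set where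
    constant : ∀ {f} c → (∀ x → f x ≡ c) → Poly≤ 0 f
    horner   : ∀ {d f} c g → Poly≤ d g → (∀ x → f x ≡ c + x * g x) → Poly≤ (suc d) f

  data Monic : ℕ → (ℤ → ℤ) → Set where
    one    : ∀ {f} → (∀ x → f x ≡ 1ℤ) → Monic 0 f
    horner : ∀ {d f} c g → Monic d g → (∀ x → f x ≡ c + x * g x) → Monic (suc d) f

  Monic⇒Poly≤ : ∀ {d f} → Monic d f → Poly≤ d f
  Monic⇒Poly≤ (one f≗1)          = constant 1ℤ f≗1
  Monic⇒Poly≤ (horner c g g-monic f≗) = horner c g (Monic⇒Poly≤ g-monic) f≗

  Poly≤-scale : ∀ {d g} r → Poly≤ d g → Poly≤ d (λ x → r * g x)
  Poly≤-scale r (constant c g≗c) = constant (r * c) (λ x → cong (r *_) (g≗c x))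
  Poly≤-scale r (horner c h h≤ g≗) =
    horner (r * c) (λ x → r * h x) (Poly≤-scale r h≤) (λ x → trans (cong (r *_) (g≗ x)) (distrib r c x (h x)))
    where
    distrib : ∀ r c x y → r * (c + x * y) ≡ r * c + x * (r * y)
    distrib = solve-∀

  Monic-+ : ∀ {d g h} → Monic (suc d) g → Poly≤ d h → Monic (suc d) (λ x → g x + h x)
  Monic-+ (horner c g′ (one g′≗1) g≗) (constant c′ h≗c′) =
    horner (c + c′) g′ (one g′≗1) (λ x → trans (cong₂ _+_ (g≗ x) (h≗c′ x)) (swap c (x * g′ x) c′))
    where
    swap : ∀ a b c → a + b + c ≡ a + c + b
    swap = solve-∀
  Monic-+ (horner c g′ g′-monic@(horner _ _ _ _) g≗) (horner c′ h′ h′≤ h≗) =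
    horner (c + c′) (λ x → g′ x + h′ x) (Monic-+ g′-monic h′≤)
      (λ x → trans (cong₂ _+_ (g≗ x) (h≗ x)) (regroup c c′ x (g′ x) (h′ x)))
    where
    regroup : ∀ a b x u v → a + x * u + (b + x * v) ≡ a + b + x * (u + v)
    regroup = solve-∀

  Monic-factor : ∀ {d f} → Monic (suc d) f → ∀ r →
    Σ (ℤ → ℤ) λ q → Monic d q × (∀ x → f x - f r ≡ (x - r) * q x)
  Monic-factor (horner c g (one g≗1) f≗) r =
    (λ _ → 1ℤ) , one (λ _ → refl) ,
    λ x → trans (cong₂ _-_ (f≗ x) (f≗ r)) (trans (cong₂ (λ u v → c + x * u - (c + r * v)) (g≗1 x) (g≗1 r)) (linear c x r))
    where
    linear : ∀ c x r → c + x * 1ℤ - (c + r * 1ℤ) ≡ (x - r) * 1ℤ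
    linear = solve-∀
  Monic-factor {f = f} (horner c g g-monic@(horner _ _ _ _) f≗) r with Monic-factor g-monic r
  ... | q , q-monic , g-factored =
    (λ x → g x + r * q x) , Monic-+ g-monic (Poly≤-scale r (Monic⇒Poly≤ q-monic)) ,
    λ x → begin
      f x - f r                              ≡⟨ cong₂ _-_ (f≗ x) (f≗ r) ⟩
      c + x * g x - (c + r * g r)            ≡⟨ split c x r (g x) (g r) ⟩
      (x - r) * g x + r * (g x - g r)        ≡⟨ cong (λ z → (x - r) * g x + r * z) (g-factored x) ⟩
      (x - r) * g x + r * ((x - r) * q x)    ≡⟨ collect x r (g x) (q x) ⟩
      (x - r) * (g x + r * q x)              ∎
    where
    open ≡-Reasoning
    split : ∀ c x r gx gr → c + x * gx - (c + r * gr) ≡ (x - r) * gx + r * (gx - gr)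
    split = solve-∀
    collect : ∀ x r gx qx → (x - r) * gx + r * ((x - r) * qx) ≡ (x - r) * (gx + r * qx)
    collect = solve-∀

  Monic-^ : ∀ k → Monic k (λ x → x ^ k)
  Monic-^ zero    = one (λ _ → refl)
  Monic-^ (suc k) = horner 0ℤ (λ x → x ^ k) (Monic-^ k) (λ x → sym (+-identityˡ (x * x ^ k)))

  Monic-^-1 : ∀ k → Monic (suc k) (λ x → x ^ suc k - 1ℤ)
  Monic-^-1 k = horner (- 1ℤ) (λ x → x ^ k) (Monic-^ k) (λ x → reorder x (x ^ k))
    where
    reorder : ∀ x y → x * y - 1ℤ ≡ - 1ℤ + x * y
    reorder = solve-∀

module PolynomialRoots (n : ℕ) (prime : Prime (ℕ.suc n)) where
  open import Data.Nat as ℕ using (suc; zero; _≤_; _<_; _≡ᵇ_; z≤n; s≤s; z<s)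
  import Data.Nat.Properties as ℕ
  open import Data.Integer hiding (suc; _≤_; _<_)
  open import Data.Bool using (Bool; true; false)
  open import Data.Bool.Properties using (¬-not)
  import Data.Bool.Properties as Bool
  open import Data.Product using (_,_)
  open import Data.Sum using ([_,_]′)
  open import Relation.Binary.PropositionalEquality
  open import Relation.Nullary using (yes; no)
  open import Function using (mk⇔)
  open import Data.Empty using (⊥-elim)
  open RangeSum
  open Polynomial
  open PrimeField n prime

  ≈0ᵇ : ℤ → Bool
  ≈0ᵇ z = ⟦ z ⟧ ≡ᵇ 0

  ≈0ᵇ⇒≈0 : ∀ z → ≈0ᵇ z ≡ true → z ≈ 0ℤ
  ≈0ᵇ⇒≈0 z e = ⟦⟧≡⇒≈ (trans (≡ᵇ-true⇒≡ ⟦ z ⟧ 0 e) (sym (⟦⟧-residue z<s)))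

  ≈0⇒≈0ᵇ : ∀ {z} → z ≈ 0ℤ → ≈0ᵇ z ≡ true
  ≈0⇒≈0ᵇ z≈0 = ≡⇒≡ᵇ-true (trans (≈⇒⟦⟧≡ z≈0) (⟦⟧-residue z<s))

  #roots : (ℤ → ℤ) → ℕ
  #roots f = ∑[ x < p ] 𝟙 (≈0ᵇ (f (+ x)))

  #roots≤degree : ∀ {d f} → Monic d f → #roots f ≤ d
  #roots≤degree {f = f} (one f≗1) = ℕ.≤-reflexive (∑-zero p (λ x _ → cong 𝟙 (no-root x)))
    where
    no-root : ∀ x → ≈0ᵇ (f (+ x)) ≡ false
    no-root x = ¬-not (λ root → 1≉0 (subst (_≈ 0ℤ) (f≗1 (+ x)) (≈0ᵇ⇒≈0 _ root)))
  #roots≤degree {suc d} {f} f-monic@(horner _ _ _ _)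
    with ℕ.anyUpTo? (λ x → ≈0ᵇ (f (+ x)) Bool.≟ true) p
  ... | no ¬root = ℕ.≤-trans (ℕ.≤-reflexive (∑-zero p (λ x x<p → cong 𝟙 (¬-not (λ root → ¬root (x , x<p , root)))))) z≤n
  ... | yes (r , r<p , fr≈0) with Monic-factor f-monic (+ r)
  ...   | q , q-monic , f-factored = begin
    #roots f                                       ≤⟨ ∑-mono p root-of-factor ⟩
    ∑[ x < p ] (δ x r ℕ.* 1 ℕ.+ 𝟙 (≈0ᵇ (q (+ x)))) ≡⟨ ∑-+ p (λ x → δ x r ℕ.* 1) (λ x → 𝟙 (≈0ᵇ (q (+ x)))) ⟩
    ∑[ x < p ] (δ x r ℕ.* 1) ℕ.+ #roots q          ≡⟨ cong (ℕ._+ #roots q) (∑-δˡ p r (λ _ → 1) r<p) ⟩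
    suc (#roots q)                                 ≤⟨ s≤s (#roots≤degree q-monic) ⟩
    suc d                                          ∎
    where
    open ℕ.≤-Reasoning
    root-of-factor : ∀ x → x < p → 𝟙 (≈0ᵇ (f (+ x))) ≤ δ x r ℕ.* 1 ℕ.+ 𝟙 (≈0ᵇ (q (+ x)))
    root-of-factor x x<p with ≈0ᵇ (f (+ x)) in fx≈0
    ... | false = z≤n
    ... | true = [ at-r , root-of-q ]′ (x*y≈0⇒x≈0∨y≈0 (+ x - + r) (q (+ x)) [x-r]qx≈0)
      where
      [x-r]qx≈0 : (+ x - + r) * q (+ x) ≈ 0ℤ
      [x-r]qx≈0 = ≈-trans (≈-reflexive (sym (f-factored (+ x))))
                          (≈-minus (≈0ᵇ⇒≈0 (f (+ x)) fx≈0) (≈0ᵇ⇒≈0 (f (+ r)) fr≈0))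
      at-r : + x - + r ≈ 0ℤ → 1 ≤ δ x r ℕ.* 1 ℕ.+ 𝟙 (≈0ᵇ (q (+ x)))
      at-r x-r≈0 = ℕ.≤-trans (ℕ.≤-reflexive (cong (λ b → 𝟙 b ℕ.* 1) (sym (≡⇒≡ᵇ-true x≡r)))) (ℕ.m≤m+n _ _)
        where x≡r = residue-injective x<p r<p (x-y≈0⇒x≈y x-r≈0)
      root-of-q : q (+ x) ≈ 0ℤ → 1 ≤ δ x r ℕ.* 1 ℕ.+ 𝟙 (≈0ᵇ (q (+ x)))
      root-of-q qx≈0 = ℕ.≤-trans (ℕ.≤-reflexive (cong 𝟙 (sym (≈0⇒≈0ᵇ qx≈0)))) (ℕ.m≤n+m _ _)

  #roots-xᵏ-1≤k : ∀ k → k ≢ 0 → #roots (λ x → x ^ k - 1ℤ) ℕ.≤ k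
  #roots-xᵏ-1≤k zero    k≢0 = ⊥-elim (k≢0 refl)
  #roots-xᵏ-1≤k (suc k) _   = #roots≤degree (Monic-^-1 k)

  ≈0ᵇ-mono : ∀ {x y} → (x ≈ 0ℤ → y ≈ 0ℤ) → 𝟙 (≈0ᵇ x) ℕ.≤ 𝟙 (≈0ᵇ y)
  ≈0ᵇ-mono {x} {y} x≈0⇒y≈0 = 𝟙-mono (λ x≈0 → ≈0⇒≈0ᵇ (x≈0⇒y≈0 (≈0ᵇ⇒≈0 x x≈0)))

  ≈0ᵇ-cong : ∀ {x y} → (x ≈ 0ℤ → y ≈ 0ℤ) → (y ≈ 0ℤ → x ≈ 0ℤ) → ≈0ᵇ x ≡ ≈0ᵇ y
  ≈0ᵇ-cong {x} {y} x⇒y y⇒x = Bool.⇔→≡ (mk⇔ (λ x≈0 → ≈0⇒≈0ᵇ (x⇒y (≈0ᵇ⇒≈0 x x≈0)))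
                                          (λ y≈0 → ≈0⇒≈0ᵇ (y⇒x (≈0ᵇ⇒≈0 y y≈0))))

  δ-⟦⟧ : ∀ x y → δ ⟦ x ⟧ ⟦ y ⟧ ≡ 𝟙 (≈0ᵇ (x - y))
  δ-⟦⟧ x y = cong 𝟙 (Bool.⇔→≡ (mk⇔
    (λ ⟦x⟧≡⟦y⟧ → ≈0⇒≈0ᵇ (x≈y⇒x-y≈0 (⟦⟧≡⇒≈ {x} {y} (≡ᵇ-true⇒≡ ⟦ x ⟧ ⟦ y ⟧ ⟦x⟧≡⟦y⟧))))
    (λ x-y≈0 → ≡⇒≡ᵇ-true (≈⇒⟦⟧≡ {x} {y} (x-y≈0⇒x≈y (≈0ᵇ⇒≈0 (x - y) x-y≈0))))))

module RootsOfUnity (n : ℕ) (prime : Prime (ℕ.suc n)) where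
  open import Data.Nat as ℕ using (suc; zero)
  import Data.Nat.Properties as ℕ
  open import Data.Nat.Divisibility as ℕ using (divides)
  open import Data.Nat.GCD using (gcd; gcd-GCD; module Bézout)
  open import Data.Integer hiding (suc)
  open import Data.Integer.Properties
  open import Data.Integer.Tactic.RingSolver using (solve-∀)
  open import Relation.Binary.PropositionalEquality
  open PrimeField n prime

  pos-^ : ∀ m k → + (m ℕ.^ k) ≡ (+ m) ^ k
  pos-^ m zero    = refl
  pos-^ m (suc k) = trans (pos-* m (m ℕ.^ k)) (cong (+ m *_) (pos-^ m k))

  ^-distribʳ-* : ∀ x y k → (x * y) ^ k ≡ x ^ k * y ^ k
  ^-distribʳ-* x y zero    = refl
  ^-distribʳ-* x y (suc k) = trans (cong (x * y *_) (^-distribʳ-* x y k)) (interchange x y (x ^ k) (y ^ k))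
    where
    interchange : ∀ x y u v → x * y * (u * v) ≡ x * u * (y * v)
    interchange = solve-∀

  ^≈1-multiple : ∀ {x} u m → x ^ m ≈ 1ℤ → x ^ (u ℕ.* m) ≈ 1ℤ
  ^≈1-multiple {x} u m xᵐ≈1 = begin
    x ^ (u ℕ.* m) ≡⟨ cong (x ^_) (ℕ.*-comm u m) ⟩
    x ^ (m ℕ.* u) ≡⟨ ^-*-assoc x m u ⟨
    (x ^ m) ^ u   ≈⟨ ≈-^ u xᵐ≈1 ⟩
    1ℤ ^ u        ≡⟨ ^-zeroˡ u ⟩
    1ℤ            ∎
    where open ≈-Reasoning

  ^≈1-∣ : ∀ {x d m} → d ℕ.∣ m → x ^ d ≈ 1ℤ → x ^ m ≈ 1ℤ
  ^≈1-∣ {d = d} (divides q refl) = ^≈1-multiple q d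

  ^≈1-cancel : ∀ {x} d s t → d ℕ.+ s ≡ t → x ^ s ≈ 1ℤ → x ^ t ≈ 1ℤ → x ^ d ≈ 1ℤ
  ^≈1-cancel {x} d s t d+s≡t xˢ≈1 xᵗ≈1 = *-cancelˡ-≈ xˢ≉0 (begin
    x ^ s * x ^ d   ≡⟨ *-comm (x ^ s) (x ^ d) ⟩
    x ^ d * x ^ s   ≡⟨ ^-distribˡ-+-* x d s ⟨
    x ^ (d ℕ.+ s)   ≡⟨ cong (x ^_) d+s≡t ⟩
    x ^ t           ≈⟨ ≈-trans xᵗ≈1 (≈-sym xˢ≈1) ⟩
    x ^ s           ≡⟨ *-identityʳ (x ^ s) ⟨
    x ^ s * 1ℤ      ∎)
    where
    open ≈-Reasoning
    xˢ≉0 : x ^ s ≉ 0ℤ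
    xˢ≉0 xˢ≈0 = 1≉0 (≈-trans (≈-sym xˢ≈1) xˢ≈0)

  ^≈1-gcd : ∀ {x} m k → x ^ m ≈ 1ℤ → x ^ k ≈ 1ℤ → x ^ gcd m k ≈ 1ℤ
  ^≈1-gcd m k xᵐ≈1 xᵏ≈1 with Bézout.identity (gcd-GCD m k)
  ... | Bézout.+- u v eq = ^≈1-cancel (gcd m k) (v ℕ.* k) (u ℕ.* m) eq (^≈1-multiple v k xᵏ≈1) (^≈1-multiple u m xᵐ≈1)
  ... | Bézout.-+ u v eq = ^≈1-cancel (gcd m k) (u ℕ.* m) (v ℕ.* k) eq (^≈1-multiple u m xᵐ≈1) (^≈1-multiple v k xᵏ≈1)

module PowerMap (n : ℕ) (prime : Prime (ℕ.suc n)) where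
  open import Data.Nat as ℕ using (suc; zero; _<_; _≤_; _≡ᵇ_; z≤n; s≤s)
  import Data.Nat.Properties as ℕ
  open import Data.Nat.Divisibility as ℕ using (divides)
  open import Data.Nat.GCD using (gcd; gcd[m,n]∣m; gcd[m,n]∣n)
  open import Function using (mk⇔)
  open import Data.Integer hiding (suc; _<_; _≤_)
  open import Data.Integer.Properties
  open import Data.Integer.Tactic.RingSolver using (solve-∀)
  open import Data.Bool using (Bool; true; false; _∧_)
  import Data.Bool.Properties as Bool
  open import Data.Product using (_×_; _,_; ∃; proj₁; proj₂)
  open import Relation.Binary.PropositionalEquality
  open import Relation.Nullary using (yes; no; does)
  open import Relation.Nullary.Decidable using (dec-true)
  open RangeSum
  open PrimeField n prime
  open Fermat n prime using (nonZeroᵇ; nonZeroᵇ-intro; nonZeroᵇ-elim; count-nonZero; fermat)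
  open RootsOfUnity n prime
  open PolynomialRoots n prime using (≈0ᵇ; ≈0⇒≈0ᵇ; #roots; #roots-xᵏ-1≤k)
  open BigOperator ℕ._+_ 0 ℕ.+-assoc ℕ.+-comm ℕ.+-identityˡ using () renaming (⨁ to ∑ᶠ; ⨁-reindex to ∑ᶠ-reindex)

  ∑ᶠ-count : ∀ m Q → ∑ᶠ m Q (λ _ → 1) ≡ ∑[ i < m ] 𝟙 (Q i)
  ∑ᶠ-count zero    Q = refl
  ∑ᶠ-count (suc m) Q with Q 0
  ... | true  = cong suc (∑ᶠ-count m (λ i → Q (suc i)))
  ... | false = ∑ᶠ-count m (λ i → Q (suc i))

  pow : ℕ → ℕ → ℕ
  pow v k = ⟦ + (v ℕ.^ k) ⟧

  pow<p : ∀ v k → pow v k < p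
  pow<p v k = ⟦⟧<p (+ (v ℕ.^ k))

  pow≈^ : ∀ v k → + pow v k ≈ (+ v) ^ k
  pow≈^ v k = ≈-trans (≈-sym (≈⟦⟧ _)) (≈-reflexive (pos-^ v k))

  pow≡ : ∀ v k {w} → w < p → (+ v) ^ k ≈ + w → pow v k ≡ w
  pow≡ v k w<p vᵏ≈w = trans (≈⇒⟦⟧≡ (≈-trans (≈-reflexive (pos-^ v k)) vᵏ≈w)) (⟦⟧-residue w<p)

  ⟦*⟧-^ : ∀ x y k → (+ ⟦ x * y ⟧) ^ k ≈ x ^ k * y ^ k
  ⟦*⟧-^ x y k = ≈-trans (≈-^ k (≈-sym (≈⟦⟧ (x * y)))) (≈-reflexive (^-distribʳ-* x y k))

  module PowerPair (a b : ℕ) where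

    -- The conjuncts are ordered so that 𝟙 (inFibre w₁ w₂ v) unfolds to the factors split off by ∑-fibres.
    inFibre : ℕ → ℕ → ℕ → Bool
    inFibre w₁ w₂ v = (pow v b ≡ᵇ w₂) ∧ ((pow v a ≡ᵇ w₁) ∧ nonZeroᵇ v)

    record Fibre (w₁ w₂ v : ℕ) : Set where
      field
        unit    : + v ≉ 0ℤ
        a-power : (+ v) ^ a ≈ + w₁
        b-power : (+ v) ^ b ≈ + w₂

    inFibre⁻ : ∀ {w₁ w₂ v} → v < p → inFibre w₁ w₂ v ≡ true → Fibre w₁ w₂ v
    inFibre⁻ {w₁} {w₂} {v} v<p v∈ with ∧-≡true⁻ {pow v b ≡ᵇ w₂} v∈
    ... | vᵇ≡w₂ , rest with ∧-≡true⁻ {pow v a ≡ᵇ w₁} rest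
    ...   | vᵃ≡w₁ , v≢0 = record
      { unit    = residue≢0⇒≉0 v<p (nonZeroᵇ-elim v≢0)
      ; a-power = ≈-trans (≈-sym (pow≈^ v a)) (≈-reflexive (cong +_ (≡ᵇ-true⇒≡ _ _ vᵃ≡w₁)))
      ; b-power = ≈-trans (≈-sym (pow≈^ v b)) (≈-reflexive (cong +_ (≡ᵇ-true⇒≡ _ _ vᵇ≡w₂)))
      }

    inFibre⇒residues : ∀ {w₁ w₂ v} → inFibre w₁ w₂ v ≡ true → w₁ < p × w₂ < p
    inFibre⇒residues {w₁} {w₂} {v} v∈ with ∧-≡true⁻ {pow v b ≡ᵇ w₂} v∈
    ... | vᵇ≡w₂ , rest =
      subst (_< p) (≡ᵇ-true⇒≡ (pow v a) w₁ (proj₁ (∧-≡true⁻ {pow v a ≡ᵇ w₁} rest))) (pow<p v a) ,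
      subst (_< p) (≡ᵇ-true⇒≡ (pow v b) w₂ vᵇ≡w₂) (pow<p v b)

    inFibre⁺ : ∀ {w₁ w₂ v} → w₁ < p → w₂ < p → Fibre w₁ w₂ v → inFibre w₁ w₂ v ≡ true
    inFibre⁺ {v = v} w₁<p w₂<p v∈ = ∧-≡true (≡⇒≡ᵇ-true (pow≡ v b w₂<p b-power))
      (∧-≡true (≡⇒≡ᵇ-true (pow≡ v a w₁<p a-power)) (nonZeroᵇ-intro (λ v≡0 → unit (≈-reflexive (cong +_ v≡0)))))
      where open Fibre v∈

    #fibre : ℕ → ℕ → ℕ
    #fibre w₁ w₂ = ∑[ v < p ] 𝟙 (inFibre w₁ w₂ v)

    inImage : ℕ → ℕ → Bool
    inImage w₁ w₂ = does (ℕ.anyUpTo? (λ v → inFibre w₁ w₂ v Bool.≟ true) p)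

    inImage⁻ : ∀ {w₁ w₂} → inImage w₁ w₂ ≡ true → ∃ λ v → v < p × inFibre w₁ w₂ v ≡ true
    inImage⁻ {w₁} {w₂} w∈ with ℕ.anyUpTo? (λ v → inFibre w₁ w₂ v Bool.≟ true) p
    ... | yes v∈ = v∈

    inImage⁺ : ∀ {w₁ w₂ v} → v < p → inFibre w₁ w₂ v ≡ true → inImage w₁ w₂ ≡ true
    inImage⁺ {w₁} {w₂} {v} v<p v∈ = dec-true (ℕ.anyUpTo? (λ v → inFibre w₁ w₂ v Bool.≟ true) p) (v , v<p , v∈)

    ∉image⇒∉fibre : ∀ {w₁ w₂} → inImage w₁ w₂ ≡ false → ∀ v → v < p → inFibre w₁ w₂ v ≡ false
    ∉image⇒∉fibre {w₁} {w₂} w∉ v v<p with ℕ.anyUpTo? (λ v → inFibre w₁ w₂ v Bool.≟ true) p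
    ... | no ∄v = Bool.¬-not (λ v∈ → ∄v (v , v<p , v∈))

    #image : ℕ
    #image = ∑[ w₁ < p ] ∑[ w₂ < p ] 𝟙 (inImage w₁ w₂)

    fibre-translation : ∀ {w₁ w₂ v₀} → w₁ < p → w₂ < p → Fibre w₁ w₂ v₀ →
      SupportBijection p (inFibre 1 1) p (inFibre w₁ w₂) (λ v → ⟦ + v * + v₀ ⟧)
    fibre-translation {w₁} {w₂} {v₀} w₁<p w₂<p v₀∈ = record
      { maps-to    = λ v v<p v∈ → ⟦⟧<p (+ v * + v₀) , inFibre⁺ w₁<p w₂<p (translate (inFibre⁻ v<p v∈))
      ; injective  = λ v v′ v<p v′<p _ _ vv₀≡v′v₀ → residue-injective v<p v′<p
          (*-cancelˡ-≈ v₀≉0 (≈-trans (≈-reflexive (*-comm (+ v₀) (+ v)))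
            (≈-trans (⟦⟧≡⇒≈ vv₀≡v′v₀) (≈-reflexive (*-comm (+ v′) (+ v₀))))))
      ; surjective = λ v v<p v∈ → ⟦ + v * u₀ ⟧ , ⟦⟧<p (+ v * u₀) ,
          inFibre⁺ 1<p 1<p (untranslate (inFibre⁻ v<p v∈)) ,
          trans (≈⇒⟦⟧≡ (≈-trans (≈-* (≈-sym (≈⟦⟧ (+ v * u₀))) (≈-refl {+ v₀})) (vu₀v₀≈v v)))
                (⟦⟧-residue v<p)
      }
      where
      open Fibre v₀∈ renaming (unit to v₀≉0; a-power to v₀ᵃ≈w₁; b-power to v₀ᵇ≈w₂)
      u₀ : ℤ
      u₀ = proj₁ (inverse v₀≉0)
      v₀u₀≈1 : + v₀ * u₀ ≈ 1ℤ
      v₀u₀≈1 = proj₂ (inverse v₀≉0)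
      vu₀v₀≈v : ∀ v → + v * u₀ * + v₀ ≈ + v
      vu₀v₀≈v v = begin
        + v * u₀ * + v₀   ≡⟨ reorder (+ v) u₀ (+ v₀) ⟩
        + v * (+ v₀ * u₀) ≈⟨ ≈-* (≈-refl {+ v}) v₀u₀≈1 ⟩
        + v * 1ℤ          ≡⟨ *-identityʳ (+ v) ⟩
        + v               ∎
        where
        open ≈-Reasoning
        reorder : ∀ x y z → x * y * z ≡ x * (z * y)
        reorder = solve-∀
      translate : ∀ {v} → Fibre 1 1 v → Fibre w₁ w₂ ⟦ + v * + v₀ ⟧
      translate {v} v∈ = record
        { unit    = λ vv₀≈0 → *-≉0 (Fibre.unit v∈) v₀≉0 (≈-trans (≈⟦⟧ (+ v * + v₀)) vv₀≈0)
        ; a-power = ≈-trans (⟦*⟧-^ (+ v) (+ v₀) a) (≈-trans (≈-* (Fibre.a-power v∈) v₀ᵃ≈w₁) (≈-reflexive (*-identityˡ (+ w₁))))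
        ; b-power = ≈-trans (⟦*⟧-^ (+ v) (+ v₀) b) (≈-trans (≈-* (Fibre.b-power v∈) v₀ᵇ≈w₂) (≈-reflexive (*-identityˡ (+ w₂))))
        }
      u₀-cancels : ∀ {v w} k → (+ v) ^ k ≈ + w → (+ v₀) ^ k ≈ + w → (+ ⟦ + v * u₀ ⟧) ^ k ≈ 1ℤ
      u₀-cancels {v} k vᵏ≈w v₀ᵏ≈w = begin
        (+ ⟦ + v * u₀ ⟧) ^ k ≈⟨ ⟦*⟧-^ (+ v) u₀ k ⟩
        (+ v) ^ k * u₀ ^ k   ≈⟨ ≈-* (≈-trans vᵏ≈w (≈-sym v₀ᵏ≈w)) (≈-refl {u₀ ^ k}) ⟩
        (+ v₀) ^ k * u₀ ^ k  ≡⟨ ^-distribʳ-* (+ v₀) u₀ k ⟨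
        (+ v₀ * u₀) ^ k      ≈⟨ ≈-^ k v₀u₀≈1 ⟩
        1ℤ ^ k               ≡⟨ ^-zeroˡ k ⟩
        1ℤ                   ∎
        where open ≈-Reasoning
      untranslate : ∀ {v} → Fibre w₁ w₂ v → Fibre 1 1 ⟦ + v * u₀ ⟧
      untranslate {v} v∈ = record
        { unit    = λ vu₀≈0 → Fibre.unit v∈ (≈-trans (≈-sym (vu₀v₀≈v v))
            (≈-* {y = + v₀} (≈-trans (≈⟦⟧ (+ v * u₀)) vu₀≈0) ≈-refl))
        ; a-power = u₀-cancels a (Fibre.a-power v∈) v₀ᵃ≈w₁
        ; b-power = u₀-cancels b (Fibre.b-power v∈) v₀ᵇ≈w₂
        }

    #fibre-translation : ∀ {w₁ w₂} → inImage w₁ w₂ ≡ true → #fibre w₁ w₂ ≡ #fibre 1 1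
    #fibre-translation {w₁} {w₂} w∈ with inImage⁻ w∈
    ... | v₀ , v₀<p , v₀∈ = begin
      #fibre w₁ w₂                        ≡⟨ ∑ᶠ-count p (inFibre w₁ w₂) ⟨
      ∑ᶠ p (inFibre w₁ w₂) (λ _ → 1)      ≡⟨ ∑ᶠ-reindex p p (λ _ → 1) (fibre-translation w₁<p w₂<p v₀∈′) ⟨
      ∑ᶠ p (inFibre 1 1) (λ _ → 1)        ≡⟨ ∑ᶠ-count p (inFibre 1 1) ⟩
      #fibre 1 1                          ∎
      where
      open ≡-Reasoning
      v₀∈′ : Fibre w₁ w₂ v₀
      v₀∈′ = inFibre⁻ v₀<p v₀∈
      w₁<p : w₁ < p
      w₁<p = proj₁ (inFibre⇒residues v₀∈)
      w₂<p : w₂ < p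
      w₂<p = proj₂ (inFibre⇒residues v₀∈)

    #fibre≡𝟙*#fibre₁₁ : ∀ w₁ w₂ → #fibre w₁ w₂ ≡ 𝟙 (inImage w₁ w₂) ℕ.* #fibre 1 1
    #fibre≡𝟙*#fibre₁₁ w₁ w₂ with inImage w₁ w₂ in w∈
    ... | true  = trans (#fibre-translation w∈) (sym (ℕ.+-identityʳ _))
    ... | false = ∑-zero p (λ v v<p → cong 𝟙 (∉image⇒∉fibre w∈ v v<p))

    ∑-#fibre : ∑[ w₁ < p ] ∑[ w₂ < p ] #fibre w₁ w₂ ≡ n
    ∑-#fibre = begin
      ∑[ w₁ < p ] ∑[ w₂ < p ] ∑[ v < p ] 𝟙 (inFibre w₁ w₂ v)
        ≡⟨ ∑-cong p (λ w₁ _ → ∑-cong p (λ w₂ _ → ∑-cong p (λ v _ → 𝟙-inFibre w₁ w₂ v))) ⟩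
      ∑[ w₁ < p ] ∑[ w₂ < p ] ∑[ v < p ] (δ (pow v b) w₂ ℕ.* (δ (pow v a) w₁ ℕ.* 𝟙 (nonZeroᵇ v)))
        ≡⟨ ∑-cong p (λ w₁ _ → ∑-fibres p p (λ v → pow v b) (λ v → δ (pow v a) w₁ ℕ.* 𝟙 (nonZeroᵇ v)) (λ v _ → pow<p v b)) ⟨
      ∑[ w₁ < p ] ∑[ v < p ] (δ (pow v a) w₁ ℕ.* 𝟙 (nonZeroᵇ v))
        ≡⟨ ∑-fibres p p (λ v → pow v a) (λ v → 𝟙 (nonZeroᵇ v)) (λ v _ → pow<p v a) ⟨
      ∑[ v < p ] 𝟙 (nonZeroᵇ v)
        ≡⟨ count-nonZero ⟩
      n ∎
      where
      open ≡-Reasoning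
      𝟙-inFibre : ∀ w₁ w₂ v → 𝟙 (inFibre w₁ w₂ v) ≡ δ (pow v b) w₂ ℕ.* (δ (pow v a) w₁ ℕ.* 𝟙 (nonZeroᵇ v))
      𝟙-inFibre w₁ w₂ v = trans (𝟙-∧ (pow v b ≡ᵇ w₂) _) (cong (δ (pow v b) w₂ ℕ.*_) (𝟙-∧ (pow v a ≡ᵇ w₁) _))

    n≡#image*#fibre₁₁ : n ≡ #image ℕ.* #fibre 1 1
    n≡#image*#fibre₁₁ = begin
      n
        ≡⟨ ∑-#fibre ⟨
      ∑[ w₁ < p ] ∑[ w₂ < p ] #fibre w₁ w₂
        ≡⟨ ∑-cong p (λ w₁ _ → ∑-cong p (λ w₂ _ → #fibre≡𝟙*#fibre₁₁ w₁ w₂)) ⟩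
      ∑[ w₁ < p ] ∑[ w₂ < p ] (𝟙 (inImage w₁ w₂) ℕ.* #fibre 1 1)
        ≡⟨ ∑-cong p (λ w₁ _ → ∑-*ʳ p (#fibre 1 1) (λ w₂ → 𝟙 (inImage w₁ w₂))) ⟩
      ∑[ w₁ < p ] (∑[ w₂ < p ] 𝟙 (inImage w₁ w₂) ℕ.* #fibre 1 1)
        ≡⟨ ∑-*ʳ p (#fibre 1 1) (λ w₁ → ∑[ w₂ < p ] 𝟙 (inImage w₁ w₂)) ⟩
      #image ℕ.* #fibre 1 1 ∎
      where open ≡-Reasoning

  isRootOfUnity : ℕ → ℕ → Bool
  isRootOfUnity l v = (pow v l ≡ᵇ 1) ∧ nonZeroᵇ v

  #rootsOfUnity : ℕ → ℕ
  #rootsOfUnity l = ∑[ v < p ] 𝟙 (isRootOfUnity l v)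

  #fibre-diagonal : ∀ l → PowerPair.#fibre l l 1 1 ≡ #rootsOfUnity l
  #fibre-diagonal l = ∑-cong p (λ v _ → cong 𝟙 (∧-duplicate (pow v l ≡ᵇ 1) (nonZeroᵇ v)))
    where
    ∧-duplicate : ∀ x y → (x ∧ (x ∧ y)) ≡ (x ∧ y)
    ∧-duplicate x y = trans (sym (Bool.∧-assoc x x y)) (cong (_∧ y) (Bool.∧-idem x))

  #rootsOfUnity≤ : ∀ l → l ≢ 0 → #rootsOfUnity l ≤ l
  #rootsOfUnity≤ l l≢0 = ℕ.≤-trans (∑-mono p root-of-xˡ-1) (#roots-xᵏ-1≤k l l≢0)
    where
    root-of-xˡ-1 : ∀ v → v < p → 𝟙 (isRootOfUnity l v) ≤ 𝟙 (≈0ᵇ ((+ v) ^ l - 1ℤ))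
    root-of-xˡ-1 v v<p = 𝟙-mono (λ v∈ → ≈0⇒≈0ᵇ (x≈y⇒x-y≈0
      (≈-trans (≈-sym (pow≈^ v l)) (≈-reflexive (cong +_ (≡ᵇ-true⇒≡ (pow v l) 1 (proj₁ (∧-≡true⁻ v∈))))))))

  n≢0 : n ≢ 0
  n≢0 n≡0 = ℕ.<-irrefl (cong suc (sym n≡0)) 1<p

  image-of-diagonal : ∀ d q {w₁ w₂} → q ℕ.* d ≡ n → PowerPair.inImage d d w₁ w₂ ≡ true →
    w₂ ≡ w₁ × (+ w₁) ^ q ≈ 1ℤ
  image-of-diagonal d q {w₁} {w₂} qd≡n w∈ with PowerPair.inImage⁻ d d w∈
  ... | v , v<p , v∈ = residue-injective w₂<p w₁<p (≈-trans (≈-sym b-power) a-power) , w₁^q≈1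
    where
    open PowerPair d d using (inFibre⁻; inFibre⇒residues)
    open PowerPair.Fibre (inFibre⁻ v<p v∈)
    w₁<p : w₁ < p
    w₁<p = proj₁ (inFibre⇒residues v∈)
    w₂<p : w₂ < p
    w₂<p = proj₂ (inFibre⇒residues v∈)
    w₁^q≈1 : (+ w₁) ^ q ≈ 1ℤ
    w₁^q≈1 = begin
      (+ w₁) ^ q     ≈⟨ ≈-^ q (≈-sym a-power) ⟩
      ((+ v) ^ d) ^ q ≡⟨ ^-*-assoc (+ v) d q ⟩
      (+ v) ^ (d ℕ.* q) ≡⟨ cong ((+ v) ^_) (trans (ℕ.*-comm d q) qd≡n) ⟩
      (+ v) ^ n      ≈⟨ fermat unit ⟩
      1ℤ             ∎
      where open ≈-Reasoning

  #image-diagonal≤ : ∀ {d q} → q ℕ.* d ≡ n → q ≢ 0 → PowerPair.#image d d ≤ q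
  #image-diagonal≤ {d} {q} qd≡n q≢0 = begin
    ∑[ w₁ < p ] ∑[ w₂ < p ] 𝟙 (inImage w₁ w₂)
      ≤⟨ ∑-mono p (λ w₁ _ → ∑-mono p (λ w₂ _ → on-diagonal w₁ w₂)) ⟩
    ∑[ w₁ < p ] ∑[ w₂ < p ] (δ w₂ w₁ ℕ.* 𝟙 (≈0ᵇ ((+ w₁) ^ q - 1ℤ)))
      ≡⟨ ∑-cong p (λ w₁ w₁<p → ∑-δˡ p w₁ (λ _ → 𝟙 (≈0ᵇ ((+ w₁) ^ q - 1ℤ))) w₁<p) ⟩
    #roots (λ x → x ^ q - 1ℤ)
      ≤⟨ #roots-xᵏ-1≤k q q≢0 ⟩
    q ∎
    where
    open ℕ.≤-Reasoning
    open PowerPair d d using (inImage)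
    on-diagonal : ∀ w₁ w₂ → 𝟙 (inImage w₁ w₂) ≤ δ w₂ w₁ ℕ.* 𝟙 (≈0ᵇ ((+ w₁) ^ q - 1ℤ))
    on-diagonal w₁ w₂ with inImage w₁ w₂ in w∈
    ... | false = z≤n
    ... | true = diagonal-root (image-of-diagonal d q qd≡n w∈)
      where
      diagonal-root : w₂ ≡ w₁ × (+ w₁) ^ q ≈ 1ℤ → 1 ≤ δ w₂ w₁ ℕ.* 𝟙 (≈0ᵇ ((+ w₁) ^ q - 1ℤ))
      diagonal-root (w₂≡w₁ , w₁^q≈1) = subst₂ (λ a b → 1 ≤ 𝟙 a ℕ.* 𝟙 b)
        (sym (≡⇒≡ᵇ-true w₂≡w₁)) (sym (≈0⇒≈0ᵇ (x≈y⇒x-y≈0 w₁^q≈1))) (s≤s z≤n)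

  -- v ↦ v ^ d sends the units onto at most q residues, all q-th roots of unity, with fibres of size
  -- #rootsOfUnity d; so n ≤ q * #rootsOfUnity d, while #rootsOfUnity d ≤ d by counting roots.
  #rootsOfUnity-∣ : ∀ {d} → d ℕ.∣ n → #rootsOfUnity d ≡ d
  #rootsOfUnity-∣ {d} (divides q n≡qd) = ℕ.≤-antisym (#rootsOfUnity≤ d d≢0) d≤#rootsOfUnity
    where
    q≢0 : q ≢ 0
    q≢0 q≡0 = n≢0 (trans n≡qd (cong (ℕ._* d) q≡0))
    d≢0 : d ≢ 0
    d≢0 d≡0 = n≢0 (trans n≡qd (trans (cong (q ℕ.*_) d≡0) (ℕ.*-zeroʳ q)))
    d≤#rootsOfUnity : d ≤ #rootsOfUnity d
    d≤#rootsOfUnity = ℕ.*-cancelˡ-≤ q {{ℕ.≢-nonZero q≢0}} (begin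
      q ℕ.* d                                    ≡⟨ n≡qd ⟨
      n                                          ≡⟨ PowerPair.n≡#image*#fibre₁₁ d d ⟩
      PowerPair.#image d d ℕ.* PowerPair.#fibre d d 1 1 ≤⟨ ℕ.*-mono-≤ (#image-diagonal≤ (sym n≡qd) q≢0) (ℕ.≤-reflexive (#fibre-diagonal d)) ⟩
      q ℕ.* #rootsOfUnity d                      ∎)
      where open ℕ.≤-Reasoning

  module _ (a b : ℕ) where
    private
      λ₁ : ℕ
      λ₁ = gcd n (gcd a b)
      module P  = PowerPair a b
      module Pλ = PowerPair λ₁ λ₁

    kernel⊆roots-of-unity-gcd : ∀ {v} → P.Fibre 1 1 v → Pλ.Fibre 1 1 v
    kernel⊆roots-of-unity-gcd {v} v∈ = record
      { unit    = unit
      ; a-power = vˡ≈1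
      ; b-power = vˡ≈1
      }
      where
      open P.Fibre v∈
      vˡ≈1 : (+ v) ^ λ₁ ≈ 1ℤ
      vˡ≈1 = ^≈1-gcd n (gcd a b) (fermat unit) (^≈1-gcd a b a-power b-power)

    roots-of-unity-gcd⊆kernel : ∀ {v} → Pλ.Fibre 1 1 v → P.Fibre 1 1 v
    roots-of-unity-gcd⊆kernel v∈ = record
      { unit    = unit
      ; a-power = ^≈1-∣ (ℕ.∣-trans (gcd[m,n]∣n n (gcd a b)) (gcd[m,n]∣m a b)) a-power
      ; b-power = ^≈1-∣ (ℕ.∣-trans (gcd[m,n]∣n n (gcd a b)) (gcd[m,n]∣n a b)) a-power
      }
      where open Pλ.Fibre v∈

    #kernel≡gcd : P.#fibre 1 1 ≡ λ₁
    #kernel≡gcd = begin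
      P.#fibre 1 1     ≡⟨ ∑-cong p (λ v v<p → cong 𝟙 (Bool.⇔→≡ (mk⇔
                            (λ v∈ → Pλ.inFibre⁺ 1<p 1<p (kernel⊆roots-of-unity-gcd (P.inFibre⁻ v<p v∈)))
                            (λ v∈ → P.inFibre⁺ 1<p 1<p (roots-of-unity-gcd⊆kernel (Pλ.inFibre⁻ v<p v∈)))))) ⟩
      Pλ.#fibre 1 1    ≡⟨ #fibre-diagonal λ₁ ⟩
      #rootsOfUnity λ₁ ≡⟨ #rootsOfUnity-∣ (gcd[m,n]∣m n (gcd a b)) ⟩
      λ₁               ∎
      where open ≡-Reasoning

    n≡#image*gcd : n ≡ P.#image ℕ.* λ₁
    n≡#image*gcd = trans P.n≡#image*#fibre₁₁ (cong (P.#image ℕ.*_) #kernel≡gcd)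

module MatrixCount (n : ℕ) (prime : Prime (ℕ.suc n)) where
  open import Data.Nat as ℕ using (suc; _<_; _≤_; s<s)
  import Data.Nat.Properties as ℕ
  open import Data.Integer hiding (suc; _<_; _≤_)
  open import Data.Integer.Properties
  open import Data.Integer.Tactic.RingSolver using (solve-∀)
  open import Data.Product using (proj₁; proj₂)
  open import Relation.Binary.PropositionalEquality
  open RangeSum
  open PrimeField n prime
  open Polynomial
  open PolynomialRoots n prime

  trᵣ : ℕ → ℕ → ℕ
  trᵣ a d = ⟦ + (a ℕ.+ d) ⟧

  detᵣ : ℕ → ℕ → ℕ → ℕ → ℕ
  detᵣ a b c d = ⟦ + (a ℕ.* d) - + (b ℕ.* c) ⟧

  trᵣ<p : ∀ a d → trᵣ a d < p
  trᵣ<p a d = ⟦⟧<p (+ (a ℕ.+ d))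

  detᵣ<p : ∀ a b c d → detᵣ a b c d < p
  detᵣ<p a b c d = ⟦⟧<p (+ (a ℕ.* d) - + (b ℕ.* c))

  ∑⁴ : (ℕ → ℕ → ℕ → ℕ → ℕ) → ℕ
  ∑⁴ F = ∑[ a < p ] ∑[ b < p ] ∑[ c < p ] ∑[ d < p ] F a b c d

  #matrices : ℕ → ℕ → ℕ
  #matrices t e = ∑⁴ (λ a b c d → δ (trᵣ a d) t ℕ.* δ (detᵣ a b c d) e)

  #products : ℤ → ℕ
  #products m = ∑[ b < p ] ∑[ c < p ] 𝟙 (≈0ᵇ (m - + b * + c))

  #divisions : ∀ m {b} → b < p → b ≢ 0 → ∑[ c < p ] 𝟙 (≈0ᵇ (m - + b * + c)) ≡ 1
  #divisions m {b} b<p b≢0 =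
    trans (∑-cong p (λ c c<p → trans (cong 𝟙 (≈0ᵇ-cong (fw c) (bw c))) (δ≡ c c<p)))
          (∑-δˡ p c₀ (λ _ → 1) (⟦⟧<p (y * m)))
    where
    y : ℤ
    y = proj₁ (inverse-residue b<p b≢0)
    by≈1 : + b * y ≈ 1ℤ
    by≈1 = proj₂ (inverse-residue b<p b≢0)
    c₀ : ℕ
    c₀ = ⟦ y * m ⟧
    δ≡ : ∀ c → c < p → 𝟙 (≈0ᵇ (+ c - y * m)) ≡ δ c c₀ ℕ.* 1
    δ≡ c c<p = trans (sym (δ-⟦⟧ (+ c) (y * m))) (trans (cong (λ z → δ z c₀) (⟦⟧-residue c<p)) (sym (ℕ.*-identityʳ _)))
    fw : ∀ c → m - + b * + c ≈ 0ℤ → + c - y * m ≈ 0ℤ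
    fw c m-bc≈0 = begin
      + c - y * m                                  ≡⟨ split (+ b) y (+ c) m ⟩
      (1ℤ - + b * y) * + c + (- y) * (m - + b * + c) ≈⟨ ≈-+ (≈-* (x≈y⇒x-y≈0 (≈-sym by≈1)) ≈-refl) (≈-* (≈-refl { - y}) m-bc≈0) ⟩
      0ℤ * + c + (- y) * 0ℤ                        ≡⟨ zeros (+ c) y ⟩
      0ℤ                                           ∎
      where
      open ≈-Reasoning
      split : ∀ b y c m → c - y * m ≡ (1ℤ - b * y) * c + (- y) * (m - b * c)
      split = solve-∀
      zeros : ∀ c y → 0ℤ * c + (- y) * 0ℤ ≡ 0ℤ
      zeros = solve-∀
    bw : ∀ c → + c - y * m ≈ 0ℤ → m - + b * + c ≈ 0ℤ
    bw c c-ym≈0 = begin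
      m - + b * + c                                ≡⟨ split (+ b) y (+ c) m ⟩
      (1ℤ - + b * y) * m + (- + b) * (+ c - y * m)    ≈⟨ ≈-+ (≈-* (x≈y⇒x-y≈0 (≈-sym by≈1)) ≈-refl) (≈-* (≈-refl { - + b}) c-ym≈0) ⟩
      0ℤ * m + (- + b) * 0ℤ                        ≡⟨ zeros m (+ b) ⟩
      0ℤ                                           ∎
      where
      open ≈-Reasoning
      split : ∀ b y c m → m - b * c ≡ (1ℤ - b * y) * m + (- b) * (c - y * m)
      split = solve-∀
      zeros : ∀ m b → 0ℤ * m + (- b) * 0ℤ ≡ 0ℤ
      zeros = solve-∀

  #products≡ : ∀ m → #products m ≡ p ℕ.* 𝟙 (≈0ᵇ m) ℕ.+ n
  #products≡ m = cong₂ ℕ._+_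
    (trans (∑-cong p (λ c _ → cong (λ z → 𝟙 (≈0ᵇ z)) (zero-row m (+ c)))) (∑-const p _))
    (trans (∑-cong n (λ b b<n → #divisions m (s<s b<n) (λ ()))) (trans (∑-const n 1) (ℕ.*-identityʳ n)))
    where
    zero-row : ∀ m c → m - 0ℤ * c ≡ m
    zero-row = solve-∀

  δ-trᵣ : ∀ a d t → d < p → t < p → δ (trᵣ a d) t ≡ δ d ⟦ + t - + a ⟧
  δ-trᵣ a d t d<p t<p = begin
    δ (trᵣ a d) t                  ≡⟨ cong (δ (trᵣ a d)) (⟦⟧-residue t<p) ⟨
    δ ⟦ + (a ℕ.+ d) ⟧ ⟦ + t ⟧      ≡⟨ δ-⟦⟧ (+ (a ℕ.+ d)) (+ t) ⟩
    𝟙 (≈0ᵇ (+ (a ℕ.+ d) - + t))    ≡⟨ cong (λ z → 𝟙 (≈0ᵇ (z - + t))) (pos-+ a d) ⟩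
    𝟙 (≈0ᵇ (+ a + + d - + t))      ≡⟨ cong (λ z → 𝟙 (≈0ᵇ z)) (solve-for-d (+ a) (+ d) (+ t)) ⟩
    𝟙 (≈0ᵇ (+ d - (+ t - + a)))    ≡⟨ δ-⟦⟧ (+ d) (+ t - + a) ⟨
    δ ⟦ + d ⟧ ⟦ + t - + a ⟧        ≡⟨ cong (λ z → δ z ⟦ + t - + a ⟧) (⟦⟧-residue d<p) ⟩
    δ d ⟦ + t - + a ⟧              ∎
    where
    open ≡-Reasoning
    solve-for-d : ∀ a d t → a + d - t ≡ d - (t - a)
    solve-for-d = solve-∀

  δ-detᵣ : ∀ a b c d e → e < p → δ (detᵣ a b c d) e ≡ 𝟙 (≈0ᵇ (+ a * + d - + e - + b * + c))
  δ-detᵣ a b c d e e<p = begin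
    δ (detᵣ a b c d) e                               ≡⟨ cong (δ (detᵣ a b c d)) (⟦⟧-residue e<p) ⟨
    δ ⟦ + (a ℕ.* d) - + (b ℕ.* c) ⟧ ⟦ + e ⟧          ≡⟨ δ-⟦⟧ (+ (a ℕ.* d) - + (b ℕ.* c)) (+ e) ⟩
    𝟙 (≈0ᵇ (+ (a ℕ.* d) - + (b ℕ.* c) - + e))        ≡⟨ cong₂ (λ u v → 𝟙 (≈0ᵇ (u - v - + e))) (pos-* a d) (pos-* b c) ⟩
    𝟙 (≈0ᵇ (+ a * + d - + b * + c - + e))            ≡⟨ cong (λ z → 𝟙 (≈0ᵇ z)) (swap (+ a * + d) (+ b * + c) (+ e)) ⟩
    𝟙 (≈0ᵇ (+ a * + d - + e - + b * + c))            ∎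
    where
    open ≡-Reasoning
    swap : ∀ x y z → x - y - z ≡ x - z - y
    swap = solve-∀

  -- For fixed a the trace forces d = t - a, and then ad - bc = e reads bc = a (t - a) - e.
  #matrices≡ : ∀ t e → t < p → e < p →
    #matrices t e ≡ ∑[ a < p ] (p ℕ.* 𝟙 (≈0ᵇ (+ a * + ⟦ + t - + a ⟧ - + e)) ℕ.+ n)
  #matrices≡ t e t<p e<p = ∑-cong p (λ a _ → begin
    ∑[ b < p ] ∑[ c < p ] ∑[ d < p ] (δ (trᵣ a d) t ℕ.* δ (detᵣ a b c d) e)
      ≡⟨ ∑-cong p (λ b _ → ∑-swap p p (λ c d → δ (trᵣ a d) t ℕ.* δ (detᵣ a b c d) e)) ⟩
    ∑[ b < p ] ∑[ d < p ] ∑[ c < p ] (δ (trᵣ a d) t ℕ.* δ (detᵣ a b c d) e)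
      ≡⟨ ∑-swap p p (λ b d → ∑[ c < p ] (δ (trᵣ a d) t ℕ.* δ (detᵣ a b c d) e)) ⟩
    ∑[ d < p ] ∑[ b < p ] ∑[ c < p ] (δ (trᵣ a d) t ℕ.* δ (detᵣ a b c d) e)
      ≡⟨ ∑-cong p (λ d d<p → trans (∑-cong p (λ b _ → ∑-*ˡ p (δ (trᵣ a d) t) (λ c → δ (detᵣ a b c d) e)))
                                   (∑-*ˡ p (δ (trᵣ a d) t) (λ b → ∑[ c < p ] δ (detᵣ a b c d) e))) ⟩
    ∑[ d < p ] (δ (trᵣ a d) t ℕ.* ∑[ b < p ] ∑[ c < p ] δ (detᵣ a b c d) e)
      ≡⟨ ∑-cong p (λ d d<p → cong (ℕ._* (∑[ b < p ] ∑[ c < p ] δ (detᵣ a b c d) e)) (δ-trᵣ a d t d<p t<p)) ⟩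
    ∑[ d < p ] (δ d (dₐ a) ℕ.* ∑[ b < p ] ∑[ c < p ] δ (detᵣ a b c d) e)
      ≡⟨ ∑-δˡ p (dₐ a) (λ d → ∑[ b < p ] ∑[ c < p ] δ (detᵣ a b c d) e) (⟦⟧<p (+ t - + a)) ⟩
    ∑[ b < p ] ∑[ c < p ] δ (detᵣ a b c (dₐ a)) e
      ≡⟨ ∑-cong p (λ b _ → ∑-cong p (λ c _ → δ-detᵣ a b c (dₐ a) e e<p)) ⟩
    #products (+ a * + dₐ a - + e)
      ≡⟨ #products≡ (+ a * + dₐ a - + e) ⟩
    p ℕ.* 𝟙 (≈0ᵇ (+ a * + dₐ a - + e)) ℕ.+ n ∎)
    where
    open ≡-Reasoning
    dₐ : ℕ → ℕ
    dₐ a = ⟦ + t - + a ⟧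

  #diagonals≤2 : ∀ t e → ∑[ a < p ] 𝟙 (≈0ᵇ (+ a * + ⟦ + t - + a ⟧ - + e)) ≤ 2
  #diagonals≤2 t e = ℕ.≤-trans (∑-mono p (λ a _ → ≈0ᵇ-mono (root-of-χ a))) (#roots≤degree χ-monic)
    where
    χ : ℤ → ℤ
    χ x = + e + x * (- + t + x * 1ℤ)
    χ-monic : Monic 2 χ
    χ-monic = horner (+ e) (λ x → - + t + x * 1ℤ) (horner (- + t) (λ _ → 1ℤ) (one (λ _ → refl)) (λ _ → refl)) (λ _ → refl)
    root-of-χ : ∀ a → + a * + ⟦ + t - + a ⟧ - + e ≈ 0ℤ → χ (+ a) ≈ 0ℤ
    root-of-χ a root = begin
      χ (+ a)                          ≡⟨ negate (+ a) (+ t) (+ e) ⟩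
      - (+ a * (+ t - + a) - + e)      ≈⟨ ≈-neg (≈-minus (≈-* (≈-refl {+ a}) (≈⟦⟧ (+ t - + a))) (≈-refl {+ e})) ⟩
      - (+ a * + ⟦ + t - + a ⟧ - + e)  ≈⟨ ≈-neg root ⟩
      - 0ℤ                             ≡⟨⟩
      0ℤ                               ∎
      where
      open ≈-Reasoning
      negate : ∀ a t e → e + a * (- t + a * 1ℤ) ≡ - (a * (t - a) - e)
      negate = solve-∀

  p*n≤#matrices : ∀ t e → t < p → e < p → p ℕ.* n ≤ #matrices t e
  p*n≤#matrices t e t<p e<p = begin
    p ℕ.* n                        ≡⟨ ∑-const p n ⟨
    ∑[ a < p ] n                   ≤⟨ ∑-mono p (λ a _ → ℕ.m≤n+m n (p ℕ.* Z a)) ⟩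
    ∑[ a < p ] (p ℕ.* Z a ℕ.+ n)   ≡⟨ #matrices≡ t e t<p e<p ⟨
    #matrices t e                  ∎
    where
    open ℕ.≤-Reasoning
    Z : ℕ → ℕ
    Z a = 𝟙 (≈0ᵇ (+ a * + ⟦ + t - + a ⟧ - + e))

  #matrices≤p*n+2p : ∀ t e → t < p → e < p → #matrices t e ≤ p ℕ.* n ℕ.+ 2 ℕ.* p
  #matrices≤p*n+2p t e t<p e<p = begin
    #matrices t e                                 ≡⟨ #matrices≡ t e t<p e<p ⟩
    ∑[ a < p ] (p ℕ.* Z a ℕ.+ n)                  ≡⟨ ∑-+ p (λ a → p ℕ.* Z a) (λ _ → n) ⟩
    ∑[ a < p ] (p ℕ.* Z a) ℕ.+ ∑[ a < p ] n       ≡⟨ cong₂ ℕ._+_ (∑-*ˡ p p Z) (∑-const p n) ⟩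
    p ℕ.* ∑[ a < p ] Z a ℕ.+ p ℕ.* n              ≤⟨ ℕ.+-monoˡ-≤ (p ℕ.* n) (ℕ.*-monoʳ-≤ p (#diagonals≤2 t e)) ⟩
    p ℕ.* 2 ℕ.+ p ℕ.* n                           ≡⟨ cong (ℕ._+ p ℕ.* n) (ℕ.*-comm p 2) ⟩
    2 ℕ.* p ℕ.+ p ℕ.* n                           ≡⟨ ℕ.+-comm (2 ℕ.* p) (p ℕ.* n) ⟩
    p ℕ.* n ℕ.+ 2 ℕ.* p                           ∎
    where
    open ℕ.≤-Reasoning
    Z : ℕ → ℕ
    Z a = 𝟙 (≈0ᵇ (+ a * + ⟦ + t - + a ⟧ - + e))

module TraceCount (n : ℕ) (prime : Prime (ℕ.suc n)) where
  open import Data.Nat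
  open import Data.Nat.Properties
  open import Data.Bool using (Bool)
  open import Relation.Binary.PropositionalEquality
  open RangeSum
  open Congruence n using (p)
  open MatrixCount n prime

  ∑⁴-cong : ∀ {F G : ℕ → ℕ → ℕ → ℕ → ℕ} → (∀ a b c d → F a b c d ≡ G a b c d) → ∑⁴ F ≡ ∑⁴ G
  ∑⁴-cong F≗G = ∑-cong p (λ a _ → ∑-cong p (λ b _ → ∑-cong p (λ c _ → ∑-cong p (λ d _ → F≗G a b c d))))

  ∑⁴-∑ : ∀ (f : ℕ → ℕ → ℕ → ℕ → ℕ → ℕ) →
    ∑⁴ (λ a b c d → ∑[ t < p ] f a b c d t) ≡ ∑[ t < p ] ∑⁴ (λ a b c d → f a b c d t)
  ∑⁴-∑ f = begin
    ∑[ a < p ] ∑[ b < p ] ∑[ c < p ] ∑[ d < p ] ∑[ t < p ] f a b c d t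
      ≡⟨ ∑-cong p (λ a _ → ∑-cong p (λ b _ → ∑-cong p (λ c _ → ∑-swap p p (f a b c)))) ⟩
    ∑[ a < p ] ∑[ b < p ] ∑[ c < p ] ∑[ t < p ] ∑[ d < p ] f a b c d t
      ≡⟨ ∑-cong p (λ a _ → ∑-cong p (λ b _ → ∑-swap p p (λ c t → ∑[ d < p ] f a b c d t))) ⟩
    ∑[ a < p ] ∑[ b < p ] ∑[ t < p ] ∑[ c < p ] ∑[ d < p ] f a b c d t
      ≡⟨ ∑-cong p (λ a _ → ∑-swap p p (λ b t → ∑[ c < p ] ∑[ d < p ] f a b c d t)) ⟩
    ∑[ a < p ] ∑[ t < p ] ∑[ b < p ] ∑[ c < p ] ∑[ d < p ] f a b c d t
      ≡⟨ ∑-swap p p (λ a t → ∑[ b < p ] ∑[ c < p ] ∑[ d < p ] f a b c d t) ⟩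
    ∑[ t < p ] ∑[ a < p ] ∑[ b < p ] ∑[ c < p ] ∑[ d < p ] f a b c d t ∎
    where open ≡-Reasoning

  ∑⁴-*ʳ : ∀ (f : ℕ → ℕ → ℕ → ℕ → ℕ) k → ∑⁴ (λ a b c d → f a b c d * k) ≡ ∑⁴ f * k
  ∑⁴-*ʳ f k =
    trans (∑-cong p (λ a _ → trans (∑-cong p (λ b _ → trans (∑-cong p (λ c _ → ∑-*ʳ p k (f a b c)))
                                                           (∑-*ʳ p k (λ c → ∑[ d < p ] f a b c d))))
                                   (∑-*ʳ p k (λ b → ∑[ c < p ] ∑[ d < p ] f a b c d))))
          (∑-*ʳ p k (λ a → ∑[ b < p ] ∑[ c < p ] ∑[ d < p ] f a b c d))

  ∑²-δ : ∀ x y (F : ℕ → ℕ → ℕ) → x < p → y < p →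
    ∑[ t < p ] ∑[ e < p ] (δ x t * δ y e * F t e) ≡ F x y
  ∑²-δ x y F x<p y<p = begin
    ∑[ t < p ] ∑[ e < p ] (δ x t * δ y e * F t e)   ≡⟨ ∑-cong p (λ t _ → ∑-cong p (λ e _ → *-assoc (δ x t) (δ y e) (F t e))) ⟩
    ∑[ t < p ] ∑[ e < p ] (δ x t * (δ y e * F t e)) ≡⟨ ∑-cong p (λ t _ → ∑-*ˡ p (δ x t) (λ e → δ y e * F t e)) ⟩
    ∑[ t < p ] (δ x t * ∑[ e < p ] (δ y e * F t e)) ≡⟨ ∑-δʳ p x (λ t → ∑[ e < p ] (δ y e * F t e)) x<p ⟩
    ∑[ e < p ] (δ y e * F x e)                       ≡⟨ ∑-δʳ p y (F x) y<p ⟩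
    F x y                                            ∎
    where open ≡-Reasoning

  ∑⁴-by-trace-det : ∀ (F : ℕ → ℕ → ℕ) →
    ∑⁴ (λ a b c d → F (trᵣ a d) (detᵣ a b c d)) ≡ ∑[ t < p ] ∑[ e < p ] (F t e * #matrices t e)
  ∑⁴-by-trace-det F = begin
    ∑⁴ (λ a b c d → F (trᵣ a d) (detᵣ a b c d))
      ≡⟨ ∑⁴-cong (λ a b c d → sym (∑²-δ (trᵣ a d) (detᵣ a b c d) F (trᵣ<p a d) (detᵣ<p a b c d))) ⟩
    ∑⁴ (λ a b c d → ∑[ t < p ] ∑[ e < p ] (χ a b c d t e * F t e))
      ≡⟨ ∑⁴-∑ (λ a b c d t → ∑[ e < p ] (χ a b c d t e * F t e)) ⟩
    ∑[ t < p ] ∑⁴ (λ a b c d → ∑[ e < p ] (χ a b c d t e * F t e))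
      ≡⟨ ∑-cong p (λ t _ → ∑⁴-∑ (λ a b c d e → χ a b c d t e * F t e)) ⟩
    ∑[ t < p ] ∑[ e < p ] ∑⁴ (λ a b c d → χ a b c d t e * F t e)
      ≡⟨ ∑-cong p (λ t _ → ∑-cong p (λ e _ → trans (∑⁴-*ʳ (λ a b c d → χ a b c d t e) (F t e))
                                                     (*-comm (#matrices t e) (F t e)))) ⟩
    ∑[ t < p ] ∑[ e < p ] (F t e * #matrices t e) ∎
    where
    open ≡-Reasoning
    χ : ℕ → ℕ → ℕ → ℕ → ℕ → ℕ → ℕ
    χ a b c d t e = δ (trᵣ a d) t * δ (detᵣ a b c d) e

  module _ (G : ℕ → ℕ → Bool) where

    #G : ℕ
    #G = ∑[ e₁ < p ] ∑[ e₂ < p ] 𝟙 (G e₁ e₂)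

    #pairs : ℕ
    #pairs = ∑⁴ (λ a b c d → ∑⁴ (λ a′ b′ c′ d′ →
               𝟙 (G (detᵣ a b c d) (detᵣ a′ b′ c′ d′)) * δ (trᵣ a d) (trᵣ a′ d′)))

    pairCount : (ℕ → ℕ → ℕ) → ℕ
    pairCount N = ∑[ t < p ] ∑[ e₁ < p ] (∑[ e₂ < p ] (𝟙 (G e₁ e₂) * N t e₂) * N t e₁)

    #pairs≡pairCount : #pairs ≡ pairCount #matrices
    #pairs≡pairCount = trans (∑⁴-cong (λ a b c d → trans (∑⁴-by-trace-det (λ t e → 𝟙 (G (detᵣ a b c d) e) * δ (trᵣ a d) t))
                                                          (same-trace (trᵣ a d) (detᵣ a b c d) (trᵣ<p a d))))
                            (∑⁴-by-trace-det (λ t₁ e₁ → ∑[ e₂ < p ] (𝟙 (G e₁ e₂) * #matrices t₁ e₂)))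
      where
      same-trace : ∀ t₁ e₁ → t₁ < p →
        ∑[ t < p ] ∑[ e < p ] (𝟙 (G e₁ e) * δ t₁ t * #matrices t e) ≡ ∑[ e₂ < p ] (𝟙 (G e₁ e₂) * #matrices t₁ e₂)
      same-trace t₁ e₁ t₁<p = trans (∑-swap p p (λ t e → 𝟙 (G e₁ e) * δ t₁ t * #matrices t e))
        (∑-cong p (λ e _ → trans (∑-cong p (λ t _ → reorder (𝟙 (G e₁ e)) (δ t₁ t) (#matrices t e)))
                                 (∑-δʳ p t₁ (λ t → 𝟙 (G e₁ e) * #matrices t e) t₁<p)))
        where
        reorder : ∀ g d m → g * d * m ≡ d * (g * m)
        reorder g d m = trans (cong (_* m) (*-comm g d)) (*-assoc d g m)

    pairCount-mono : ∀ {M N : ℕ → ℕ → ℕ} → (∀ t e → t < p → e < p → M t e ≤ N t e) → pairCount M ≤ pairCount N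
    pairCount-mono M≤N = ∑-mono p (λ t t<p → ∑-mono p (λ e₁ e₁<p →
      *-mono-≤ (∑-mono p (λ e₂ e₂<p → *-monoʳ-≤ (𝟙 (G e₁ e₂)) (M≤N t e₂ t<p e₂<p))) (M≤N t e₁ t<p e₁<p)))

    pairCount-const : ∀ c → pairCount (λ _ _ → c) ≡ p * (#G * (c * c))
    pairCount-const c = begin
      ∑[ t < p ] ∑[ e₁ < p ] (∑[ e₂ < p ] (𝟙 (G e₁ e₂) * c) * c)
        ≡⟨ ∑-cong p (λ t _ → ∑-cong p (λ e₁ _ → trans (cong (_* c) (∑-*ʳ p c (λ e₂ → 𝟙 (G e₁ e₂))))
                                                      (*-assoc (∑[ e₂ < p ] 𝟙 (G e₁ e₂)) c c))) ⟩
      ∑[ t < p ] ∑[ e₁ < p ] (∑[ e₂ < p ] 𝟙 (G e₁ e₂) * (c * c))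
        ≡⟨ ∑-cong p (λ t _ → ∑-*ʳ p (c * c) (λ e₁ → ∑[ e₂ < p ] 𝟙 (G e₁ e₂))) ⟩
      ∑[ t < p ] (#G * (c * c))
        ≡⟨ ∑-const p (#G * (c * c)) ⟩
      p * (#G * (c * c)) ∎
      where open ≡-Reasoning

    #pairs≥ : p * (#G * (p * n * (p * n))) ≤ #pairs
    #pairs≥ = begin
      p * (#G * (p * n * (p * n)))  ≡⟨ pairCount-const (p * n) ⟨
      pairCount (λ _ _ → p * n)     ≤⟨ pairCount-mono (λ t e t<p e<p → p*n≤#matrices t e t<p e<p) ⟩
      pairCount #matrices           ≡⟨ #pairs≡pairCount ⟨
      #pairs                       ∎
      where open ≤-Reasoning

    #pairs≤ : #pairs ≤ p * (#G * ((p * n + 2 * p) * (p * n + 2 * p)))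
    #pairs≤ = begin
      #pairs                                 ≡⟨ #pairs≡pairCount ⟩
      pairCount #matrices                     ≤⟨ pairCount-mono (λ t e t<p e<p → #matrices≤p*n+2p t e t<p e<p) ⟩
      pairCount (λ _ _ → p * n + 2 * p)       ≡⟨ pairCount-const (p * n + 2 * p) ⟩
      p * (#G * ((p * n + 2 * p) * (p * n + 2 * p))) ∎
      where open ≤-Reasoning

module Enumeration where
  open import Data.Nat
  open import Data.Nat.Properties
  open import Data.Nat.ListAction using (sum)
  open import Data.Nat.ListAction.Properties using (sum-++)
  open import Data.Fin as Fin using (Fin; toℕ)
  open import Data.List using (List; []; _∷_; map; concatMap; length; filterᵇ; allFin)
  open import Data.List.Properties using (map-++; map-tabulate)
  open import Data.Bool using (Bool; true; false)
  open import Data.Product using (_,_; _×_)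
  open import Relation.Binary.PropositionalEquality
  open import Relation.Nullary using (yes; no)
  open import Relation.Nullary.Decidable using (⌊_⌋)
  open import Defs using (Mat2; allMat2; allPairs)
  open RangeSum

  ∑ˡ : {A : Set} → List A → (A → ℕ) → ℕ
  ∑ˡ xs f = sum (map f xs)

  length-filterᵇ : ∀ {A : Set} (P : A → Bool) xs → length (filterᵇ P xs) ≡ ∑ˡ xs (λ x → 𝟙 (P x))
  length-filterᵇ P []       = refl
  length-filterᵇ P (x ∷ xs) with P x
  ... | true  = cong suc (length-filterᵇ P xs)
  ... | false = length-filterᵇ P xs

  ∑ˡ-cong : ∀ {A : Set} (xs : List A) {f g : A → ℕ} → (∀ x → f x ≡ g x) → ∑ˡ xs f ≡ ∑ˡ xs g
  ∑ˡ-cong []       f≗g = refl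
  ∑ˡ-cong (x ∷ xs) f≗g = cong₂ _+_ (f≗g x) (∑ˡ-cong xs f≗g)

  ∑ˡ-map : ∀ {A B : Set} (g : A → B) xs (f : B → ℕ) → ∑ˡ (map g xs) f ≡ ∑ˡ xs (λ x → f (g x))
  ∑ˡ-map g []       f = refl
  ∑ˡ-map g (x ∷ xs) f = cong (f (g x) +_) (∑ˡ-map g xs f)

  ∑ˡ-concatMap : ∀ {A B : Set} (g : A → List B) xs (f : B → ℕ) →
    ∑ˡ (concatMap g xs) f ≡ ∑ˡ xs (λ x → ∑ˡ (g x) f)
  ∑ˡ-concatMap g []       f = refl
  ∑ˡ-concatMap g (x ∷ xs) f = begin
    sum (map f (g x Data.List.++ concatMap g xs))       ≡⟨ cong sum (map-++ f (g x) (concatMap g xs)) ⟩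
    sum (map f (g x) Data.List.++ map f (concatMap g xs)) ≡⟨ sum-++ (map f (g x)) _ ⟩
    ∑ˡ (g x) f + ∑ˡ (concatMap g xs) f                  ≡⟨ cong (∑ˡ (g x) f +_) (∑ˡ-concatMap g xs f) ⟩
    ∑ˡ (g x) f + ∑ˡ xs (λ x → ∑ˡ (g x) f)               ∎
    where open ≡-Reasoning

  ∑ˡ-allFin : ∀ m (F : ℕ → ℕ) → ∑ˡ (allFin m) (λ i → F (toℕ i)) ≡ ∑ m F
  ∑ˡ-allFin zero    F = refl
  ∑ˡ-allFin (suc m) F = cong (F 0 +_) (begin
    ∑ˡ (Data.List.tabulate {n = m} Fin.suc) (λ i → F (toℕ i)) ≡⟨ cong (λ xs → ∑ˡ xs (λ i → F (toℕ i))) (map-tabulate {n = m} (λ i → i) Fin.suc) ⟨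
    ∑ˡ (map Fin.suc (allFin m)) (λ i → F (toℕ i))              ≡⟨ ∑ˡ-map Fin.suc (allFin m) (λ i → F (toℕ i)) ⟩
    ∑ˡ (allFin m) (λ i → F (suc (toℕ i)))                      ≡⟨ ∑ˡ-allFin m (λ i → F (suc i)) ⟩
    ∑ m (λ i → F (suc i))                                      ∎)
    where open ≡-Reasoning

  ∑ˡ-allMat2 : ∀ ℓ (H : Mat2 ℓ → ℕ) (F : ℕ → ℕ → ℕ → ℕ → ℕ) →
    (∀ a b c d → H (a , b , c , d) ≡ F (toℕ a) (toℕ b) (toℕ c) (toℕ d)) →
    ∑ˡ (allMat2 ℓ) H ≡ ∑[ a < ℓ ] ∑[ b < ℓ ] ∑[ c < ℓ ] ∑[ d < ℓ ] F a b c d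
  ∑ˡ-allMat2 ℓ H F H≗F =
    trans (∑ˡ-concatMap _ (allFin ℓ) H) (trans (∑ˡ-cong (allFin ℓ) rows-b) (∑ˡ-allFin ℓ (λ a → ∑[ b < ℓ ] ∑[ c < ℓ ] ∑[ d < ℓ ] F a b c d)))
    where
    rows-d : ∀ a b c → ∑ˡ (map (λ d → (a , b , c , d)) (allFin ℓ)) H ≡ ∑[ d < ℓ ] F (toℕ a) (toℕ b) (toℕ c) d
    rows-d a b c = trans (∑ˡ-map _ (allFin ℓ) H)
      (trans (∑ˡ-cong (allFin ℓ) (H≗F a b c)) (∑ˡ-allFin ℓ (F (toℕ a) (toℕ b) (toℕ c))))
    rows-c : ∀ a b → ∑ˡ (concatMap (λ c → map (λ d → (a , b , c , d)) (allFin ℓ)) (allFin ℓ)) H ≡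
                     ∑[ c < ℓ ] ∑[ d < ℓ ] F (toℕ a) (toℕ b) c d
    rows-c a b = trans (∑ˡ-concatMap _ (allFin ℓ) H)
      (trans (∑ˡ-cong (allFin ℓ) (rows-d a b)) (∑ˡ-allFin ℓ (λ c → ∑[ d < ℓ ] F (toℕ a) (toℕ b) c d)))
    rows-b : ∀ a → ∑ˡ (concatMap (λ b → concatMap (λ c → map (λ d → (a , b , c , d)) (allFin ℓ)) (allFin ℓ)) (allFin ℓ)) H ≡
                   ∑[ b < ℓ ] ∑[ c < ℓ ] ∑[ d < ℓ ] F (toℕ a) b c d
    rows-b a = trans (∑ˡ-concatMap _ (allFin ℓ) H)
      (trans (∑ˡ-cong (allFin ℓ) (rows-c a)) (∑ˡ-allFin ℓ (λ b → ∑[ c < ℓ ] ∑[ d < ℓ ] F (toℕ a) b c d)))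

  length-filter-allPairs : ∀ ℓ (P : Mat2 ℓ × Mat2 ℓ → Bool) →
    length (filterᵇ P (allPairs ℓ)) ≡ ∑ˡ (allMat2 ℓ) (λ A → ∑ˡ (allMat2 ℓ) (λ B → 𝟙 (P (A , B))))
  length-filter-allPairs ℓ P =
    trans (length-filterᵇ P (allPairs ℓ))
      (trans (∑ˡ-concatMap (λ A → map (λ B → (A , B)) (allMat2 ℓ)) (allMat2 ℓ) (λ q → 𝟙 (P q)))
             (∑ˡ-cong (allMat2 ℓ) (λ A → ∑ˡ-map (λ B → (A , B)) (allMat2 ℓ) (λ q → 𝟙 (P q)))))

  ⌊≟⌋≡≡ᵇ : ∀ x y → ⌊ x ≟ y ⌋ ≡ (x ≡ᵇ y)
  ⌊≟⌋≡≡ᵇ x y with x ≟ y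
  ... | yes refl = sym (≡ᵇ-refl x)
  ... | no  x≢y  = sym (≢⇒≡ᵇ-false x y x≢y)

module RationalBound where
  open import Data.Nat as ℕ using (ℕ; zero; suc)
  import Data.Nat.Properties as ℕ
  open import Data.Integer as ℤ using (+_)
  import Data.Integer.Properties as ℤ
  open import Data.Integer.Tactic.RingSolver using (solve-∀)
  open import Data.Rational using (ℚ; mkℚ; 1ℚ; _+_; _*_; _-_; -_; _≤_; ∣_∣; Positive)
  import Data.Rational.Properties as ℚ
  open import Data.Rational.Unnormalised using (*≡*; *≤*)
  import Data.Rational.Unnormalised.Properties as ℚᵘ
  import Data.Rational.Solver
  open import Data.Nat.Coprimality as Coprime using (1-coprimeTo)
  open import Data.Sum using (inj₁; inj₂)
  open import Data.Empty using (⊥-elim)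
  open import Relation.Binary.PropositionalEquality
  open import Defs using (ℕ→ℚ; divℕ)
  open Data.Rational.Solver.+-*-Solver using (solve; _:+_; _:-_; _:*_; :-_; _:=_)

  [_/1] : ℕ → ℚ
  [ m /1] = mkℚ (+ m) 0 (Coprime.sym (1-coprimeTo m))

  ℕ→ℚ≡[/1] : ∀ m → ℕ→ℚ m ≡ [ m /1]
  ℕ→ℚ≡[/1] m = ℚ.normalize-coprime (Coprime.sym (1-coprimeTo m))

  ℕ→ℚ-+ : ∀ m k → ℕ→ℚ (m ℕ.+ k) ≡ ℕ→ℚ m + ℕ→ℚ k
  ℕ→ℚ-+ m k rewrite ℕ→ℚ≡[/1] (m ℕ.+ k) | ℕ→ℚ≡[/1] m | ℕ→ℚ≡[/1] k =
    ℚ.toℚᵘ-injective (ℚᵘ.≃-trans (*≡* numerators) (ℚᵘ.≃-sym (ℚ.toℚᵘ-homo-+ [ m /1] [ k /1])))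
    where
    over-1 : ∀ a b → (a ℤ.+ b) ℤ.* ℤ.1ℤ ≡ (a ℤ.* ℤ.1ℤ ℤ.+ b ℤ.* ℤ.1ℤ) ℤ.* ℤ.1ℤ
    over-1 = solve-∀
    numerators : + (m ℕ.+ k) ℤ.* ℤ.1ℤ ≡ (+ m ℤ.* ℤ.1ℤ ℤ.+ + k ℤ.* ℤ.1ℤ) ℤ.* ℤ.1ℤ
    numerators = trans (cong (ℤ._* ℤ.1ℤ) (ℤ.pos-+ m k)) (over-1 (+ m) (+ k))

  ℕ→ℚ-* : ∀ m k → ℕ→ℚ (m ℕ.* k) ≡ ℕ→ℚ m * ℕ→ℚ k
  ℕ→ℚ-* m k rewrite ℕ→ℚ≡[/1] (m ℕ.* k) | ℕ→ℚ≡[/1] m | ℕ→ℚ≡[/1] k =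
    ℚ.toℚᵘ-injective (ℚᵘ.≃-trans (*≡* (cong (ℤ._* ℤ.1ℤ) (ℤ.pos-* m k)))
                                  (ℚᵘ.≃-sym (ℚ.toℚᵘ-homo-* [ m /1] [ k /1])))

  ℕ→ℚ-mono-≤ : ∀ {m k} → m ℕ.≤ k → ℕ→ℚ m ≤ ℕ→ℚ k
  ℕ→ℚ-mono-≤ {m} {k} m≤k rewrite ℕ→ℚ≡[/1] m | ℕ→ℚ≡[/1] k =
    ℚ.toℚᵘ-cancel-≤ (*≤* (subst₂ ℤ._≤_ (sym (ℤ.*-identityʳ (+ m))) (sym (ℤ.*-identityʳ (+ k))) (ℤ.+≤+ m≤k)))

  ℕ→ℚ[1+m]*1/[1+m]≡1 : ∀ m → ℕ→ℚ (suc m) * (+ 1 Data.Rational./ suc m) ≡ 1ℚ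
  ℕ→ℚ[1+m]*1/[1+m]≡1 m rewrite ℕ→ℚ≡[/1] (suc m) | ℚ.normalize-coprime {1} {m} (1-coprimeTo (suc m)) =
    ℚ.toℚᵘ-injective (ℚᵘ.≃-trans (ℚ.toℚᵘ-homo-* [ suc m /1] (mkℚ (+ 1) m (1-coprimeTo (suc m)))) (*≡* cross))
    where
    cross : (+ suc m ℤ.* + 1) ℤ.* ℤ.1ℤ ≡ ℤ.1ℤ ℤ.* + (1 ℕ.* suc m)
    cross = trans (ℤ.*-identityʳ _) (trans (ℤ.*-identityʳ _)
              (trans (cong +_ (sym (ℕ.*-identityˡ (suc m)))) (sym (ℤ.*-identityˡ _))))

  ℕ→ℚ-positive : ∀ m → Positive (ℕ→ℚ (suc m))
  ℕ→ℚ-positive m rewrite ℕ→ℚ≡[/1] (suc m) = _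

  private
    distrib-diff : ∀ L x A r → L * (x - A * r) ≡ L * x - A * (L * r)
    distrib-diff = solve 4 (λ L x A r → L :* (x :- A :* r) := L :* x :- A :* (L :* r)) refl

    distrib-neg-diff : ∀ L x A r → L * (- (x - A * r)) ≡ A * (L * r) - L * x
    distrib-neg-diff = solve 4 (λ L x A r → L :* (:- (x :- A :* r)) := A :* (L :* r) :- L :* x) refl

    cancel-+ : ∀ b c → b + c - b ≡ c
    cancel-+ = solve 2 (λ b c → b :+ c :- b := c) refl

    ≤+⇒-≤ : ∀ {a} b c → a ≤ b + c → a - b ≤ c
    ≤+⇒-≤ b c a≤b+c = ℚ.≤-trans (ℚ.+-monoˡ-≤ (- b) a≤b+c) (ℚ.≤-reflexive (cancel-+ b c))

  private module _ (X m A D : ℕ) where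
    private
      l x a d r : ℚ
      l = ℕ→ℚ (suc m)
      x = ℕ→ℚ X
      a = ℕ→ℚ A
      d = ℕ→ℚ D
      r = + 1 Data.Rational./ suc m
      l*r≡1 : l * r ≡ 1ℚ
      l*r≡1 = ℕ→ℚ[1+m]*1/[1+m]≡1 m

    ∣x-a/[1+m]∣≤d : suc m ℕ.* X ℕ.≤ A ℕ.+ suc m ℕ.* D → A ℕ.≤ suc m ℕ.* X ℕ.+ suc m ℕ.* D →
      ∣ ℕ→ℚ X - divℕ (ℕ→ℚ A) (suc m) ∣ ≤ ℕ→ℚ D
    ∣x-a/[1+m]∣≤d lX≤A+lD A≤lX+lD with ℚ.∣p∣≡p∨∣p∣≡-p (x - a * r)
    ... | inj₁ ∣q∣≡q rewrite ∣q∣≡q = ℚ.*-cancelˡ-≤-pos l {{ℕ→ℚ-positive m}} (begin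
      l * (x - a * r)     ≡⟨ distrib-diff l x a r ⟩
      l * x - a * (l * r) ≡⟨ cong (λ z → l * x - a * z) l*r≡1 ⟩
      l * x - a * 1ℚ      ≡⟨ cong (λ z → l * x - z) (ℚ.*-identityʳ a) ⟩
      l * x - a           ≤⟨ ≤+⇒-≤ a (l * d) (subst₂ _≤_ (ℕ→ℚ-* (suc m) X)
                               (trans (ℕ→ℚ-+ A (suc m ℕ.* D)) (cong (λ z → a + z) (ℕ→ℚ-* (suc m) D))) (ℕ→ℚ-mono-≤ lX≤A+lD)) ⟩
      l * d               ∎)
      where open ℚ.≤-Reasoning
    ... | inj₂ ∣q∣≡-q rewrite ∣q∣≡-q = ℚ.*-cancelˡ-≤-pos l {{ℕ→ℚ-positive m}} (begin
      l * (- (x - a * r)) ≡⟨ distrib-neg-diff l x a r ⟩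
      a * (l * r) - l * x ≡⟨ cong (λ z → a * z - l * x) l*r≡1 ⟩
      a * 1ℚ - l * x      ≡⟨ cong (_- l * x) (ℚ.*-identityʳ a) ⟩
      a - l * x           ≤⟨ ≤+⇒-≤ (l * x) (l * d) (subst (a ≤_)
                               (trans (ℕ→ℚ-+ (suc m ℕ.* X) (suc m ℕ.* D)) (cong₂ _+_ (ℕ→ℚ-* (suc m) X) (ℕ→ℚ-* (suc m) D)))
                               (ℕ→ℚ-mono-≤ A≤lX+lD)) ⟩
      l * d               ∎)
      where open ℚ.≤-Reasoning

  ∣x-a/l∣≤d : ∀ l X A D → l ≢ 0 → l ℕ.* X ℕ.≤ A ℕ.+ D → A ℕ.≤ l ℕ.* X ℕ.+ D →
    ∣ ℕ→ℚ X - divℕ (ℕ→ℚ A) l ∣ ≤ ℕ→ℚ D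
  ∣x-a/l∣≤d zero    X A D l≢0 _       _       = ⊥-elim (l≢0 refl)
  ∣x-a/l∣≤d (suc m) X A D _   lX≤A+D A≤lX+D =
    ∣x-a/[1+m]∣≤d X m A D (ℕ.≤-trans lX≤A+D (ℕ.+-monoʳ-≤ A D≤lD)) (ℕ.≤-trans A≤lX+D (ℕ.+-monoʳ-≤ (suc m ℕ.* X) D≤lD))
    where
    D≤lD : D ℕ.≤ suc m ℕ.* D
    D≤lD = ℕ.m≤m+n D (m ℕ.* D)

module LoefflerImage (n : ℕ) (prime : Prime (ℕ.suc n)) (k₁ k₂ : ℕ) where
  open import Data.Nat as ℕ using (suc; _<_; _∸_)
  open import Data.Integer hiding (suc; _<_)
  open import Data.Integer.Properties using (pos-*)
  open import Data.Fin using (toℕ; fromℕ<)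
  open import Data.Fin.Properties using (toℕ<n; toℕ-fromℕ<)
  open import Data.Product using (_,_; proj₁; proj₂)
  open import Function using (_⇔_; mk⇔; case_of_)
  open import Data.Bool using (true)
  open import Relation.Binary.PropositionalEquality
  open import Defs using (Mat2; det; IsUnit; LoefflerSet)
  open RangeSum
  open PrimeField n prime
  open Fermat n prime using (nonZeroᵇ-intro)
  open RootsOfUnity n prime using (pos-^)
  open PowerMap n prime using (pow; pow≡; module PowerPair)
  open PowerPair (k₁ ∸ 1) (k₂ ∸ 1) using (inImage; inImage⁺; inImage⁻; inFibre⁻)

  IsUnit⇒≢0 : ∀ {u} → IsUnit p u → u ≢ 0
  IsUnit⇒≢0 (w , 0w≡1) refl = case trans 0w≡1 (⟦⟧-residue 1<p) of λ ()

  IsUnit-residue : ∀ {u} → u < p → u ≢ 0 → IsUnit p u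
  IsUnit-residue {u} u<p u≢0 =
    fromℕ< (⟦⟧<p y) , subst (λ w → ⟦ + (u ℕ.* w) ⟧ ≡ ⟦ 1ℤ ⟧) (sym (toℕ-fromℕ< (⟦⟧<p y)))
    (≈⇒⟦⟧≡ (≈-trans (≈-reflexive (pos-* u ⟦ y ⟧)) (≈-trans (≈-* (≈-refl {+ u}) (≈-sym (≈⟦⟧ y))) uy≈1)))
    where
    y : ℤ
    y = proj₁ (inverse-residue u<p u≢0)
    uy≈1 : + u * y ≈ 1ℤ
    uy≈1 = proj₂ (inverse-residue u<p u≢0)

  pow≢0 : ∀ {v} k → v < p → v ≢ 0 → pow v k ≢ 0
  pow≢0 {v} k v<p v≢0 =
    ≉0⇒⟦⟧≢0 (λ vᵏ≈0 → ^-≉0 k (residue≢0⇒≉0 v<p v≢0) (≈-trans (≈-reflexive (sym (pos-^ v k))) vᵏ≈0))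

  det<p : ∀ (A : Mat2 p) → det A < p
  det<p (a , b , c , d) = ⟦⟧<p (+ (toℕ a ℕ.* toℕ d) - + (toℕ b ℕ.* toℕ c))

  LoefflerSet⇔inImage : ∀ A B → LoefflerSet k₁ k₂ p (A , B) ⇔ (inImage (det A) (det B) ≡ true)
  LoefflerSet⇔inImage A B = mk⇔ to from
    where
    to : LoefflerSet k₁ k₂ p (A , B) → inImage (det A) (det B) ≡ true
    to (_ , _ , v , v-unit , detA≡vᵃ , detB≡vᵇ) = inImage⁺ (toℕ<n v)
      (∧-≡true (≡⇒≡ᵇ-true (sym detB≡vᵇ)) (∧-≡true (≡⇒≡ᵇ-true (sym detA≡vᵃ)) (nonZeroᵇ-intro (IsUnit⇒≢0 {toℕ v} v-unit))))
    from : inImage (det A) (det B) ≡ true → LoefflerSet k₁ k₂ p (A , B)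
    from w∈ with inImage⁻ w∈
    ... | v , v<p , v∈ =
      IsUnit-residue (det<p A) (subst (_≢ 0) vᵃ≡detA (pow≢0 (k₁ ∸ 1) v<p v≢0)) ,
      IsUnit-residue (det<p B) (subst (_≢ 0) vᵇ≡detB (pow≢0 (k₂ ∸ 1) v<p v≢0)) ,
      fromℕ< v<p , IsUnit-residue (toℕ<n (fromℕ< v<p)) (subst (_≢ 0) (sym v≡v′) v≢0) ,
      trans (sym vᵃ≡detA) (cong (λ z → pow z (k₁ ∸ 1)) (sym v≡v′)) ,
      trans (sym vᵇ≡detB) (cong (λ z → pow z (k₂ ∸ 1)) (sym v≡v′))
      where
      open PowerPair.Fibre (inFibre⁻ v<p v∈)
      vᵃ≡detA : pow v (k₁ ∸ 1) ≡ det A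
      vᵃ≡detA = pow≡ v (k₁ ∸ 1) (det<p A) a-power
      vᵇ≡detB : pow v (k₂ ∸ 1) ≡ det B
      vᵇ≡detB = pow≡ v (k₂ ∸ 1) (det<p B) b-power
      v≢0 : v ≢ 0
      v≢0 v≡0 = unit (≈-reflexive (cong +_ v≡0))
      v≡v′ : toℕ (fromℕ< v<p) ≡ v
      v≡v′ = toℕ-fromℕ< v<p

module Estimate (n : ℕ) (prime : Prime (ℕ.suc n)) (k₁ k₂ : ℕ) where
  open import Data.Nat
  open import Data.Nat.Properties
  open import Data.Nat.GCD using (gcd[m,n]≢0)
  open import Data.Nat.Solver using (module +-*-Solver)
  open import Data.Bool using (Bool; true; _∧_)
  import Data.Bool.Properties as Bool
  open import Data.Product using (_×_; _,_; proj₁; proj₂)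
  open import Data.Fin using (toℕ)
  open import Data.Sum using (inj₁)
  open import Function using (_⇔_; mk⇔; Equivalence)
  open import Relation.Binary.PropositionalEquality
  open import Relation.Nullary.Decidable using (⌊_⌋)
  open import Data.Rational as ℚ using (ℚ)
  open import Defs using (Mat2; tr; det; Family; LoefflerSet; cardC; lambda1; ℕ→ℚ; divℕ)
  open RangeSum
  open Congruence n using (p)
  open PowerMap n prime using (module PowerPair; n≡#image*gcd; n≢0)
  open PowerPair (k₁ ∸ 1) (k₂ ∸ 1) using (inImage)
  open MatrixCount n prime using (trᵣ; detᵣ; ∑⁴)
  open TraceCount n prime using (#pairs; #pairs≥; #pairs≤)
  open Enumeration
  open LoefflerImage n prime k₁ k₂ using (LoefflerSet⇔inImage)
  open RationalBound using (ℕ→ℚ-*; ∣x-a/l∣≤d)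

  λ₁ : ℕ
  λ₁ = lambda1 p k₁ k₂

  -- With p = n + 1: p n (p (n + 2))² = p⁶ + p⁵ - p⁴ - p³ and p n (p n)² = p⁶ - 3p⁵ + 3p⁴ - p³.
  private
    upper-identity : ∀ n → suc n * (n * ((suc n * n + 2 * suc n) * (suc n * n + 2 * suc n))) + suc n ^ 4 + suc n ^ 3 ≡
                           suc n ^ 6 + suc n ^ 5
    upper-identity = solve 1 (λ n → let p = con 1 :+ n; hi = p :* n :+ con 2 :* p in
      p :* (n :* (hi :* hi)) :+ p :^ 4 :+ p :^ 3 := p :^ 6 :+ p :^ 5) refl
      where open +-*-Solver

    lower-identity : ∀ n → suc n * (n * (suc n * n * (suc n * n))) + 3 * suc n ^ 5 ≡
                           suc n ^ 6 + suc n ^ 3 * (3 * n + 2)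
    lower-identity = solve 1 (λ n → let p = con 1 :+ n; lo = p :* n in
      p :* (n :* (lo :* lo)) :+ con 3 :* p :^ 5 := p :^ 6 :+ p :^ 3 :* (con 3 :* n :+ con 2)) refl
      where open +-*-Solver

    rearrange : ∀ p g h l → l * (p * (g * h)) ≡ p * (g * l) * h
    rearrange = solve 4 (λ p g h l → l :* (p :* (g :* h)) := p :* (g :* l) :* h) refl
      where open +-*-Solver

  open PowerPair (k₁ ∸ 1) (k₂ ∸ 1) using (#image)

  n≡#image*λ₁ : n ≡ #image * λ₁
  n≡#image*λ₁ = n≡#image*gcd (k₁ ∸ 1) (k₂ ∸ 1)

  λ₁*#pairs≤ : λ₁ * #pairs inImage ≤ p ^ 6 + p ^ 5
  λ₁*#pairs≤ = begin
    λ₁ * #pairs inImage                    ≤⟨ *-monoʳ-≤ λ₁ (#pairs≤ inImage) ⟩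
    λ₁ * (p * (#image * (hi * hi)))        ≡⟨ rearrange p #image (hi * hi) λ₁ ⟩
    p * (#image * λ₁) * (hi * hi)          ≡⟨ cong (λ m → p * m * (hi * hi)) n≡#image*λ₁ ⟨
    p * n * (hi * hi)                      ≡⟨ *-assoc p n (hi * hi) ⟩
    p * (n * (hi * hi))                    ≤⟨ m≤m+n _ (p ^ 4 + p ^ 3) ⟩
    p * (n * (hi * hi)) + (p ^ 4 + p ^ 3)  ≡⟨ +-assoc (p * (n * (hi * hi))) (p ^ 4) (p ^ 3) ⟨
    p * (n * (hi * hi)) + p ^ 4 + p ^ 3    ≡⟨ upper-identity n ⟩
    p ^ 6 + p ^ 5                          ∎
    where
    open ≤-Reasoning
    hi : ℕ
    hi = p * n + 2 * p

  p⁶≤λ₁*#pairs+3p⁵ : p ^ 6 ≤ λ₁ * #pairs inImage + 3 * p ^ 5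
  p⁶≤λ₁*#pairs+3p⁵ = begin
    p ^ 6                                        ≤⟨ m≤m+n (p ^ 6) _ ⟩
    p ^ 6 + p ^ 3 * (3 * n + 2)                  ≡⟨ lower-identity n ⟨
    p * (n * (lo * lo)) + 3 * p ^ 5              ≡⟨ cong (_+ 3 * p ^ 5) (*-assoc p n (lo * lo)) ⟨
    p * n * (lo * lo) + 3 * p ^ 5                ≡⟨ cong (λ m → p * m * (lo * lo) + 3 * p ^ 5) n≡#image*λ₁ ⟩
    p * (#image * λ₁) * (lo * lo) + 3 * p ^ 5    ≡⟨ cong (_+ 3 * p ^ 5) (rearrange p #image (lo * lo) λ₁) ⟨
    λ₁ * (p * (#image * (lo * lo))) + 3 * p ^ 5  ≤⟨ +-monoˡ-≤ (3 * p ^ 5) (*-monoʳ-≤ λ₁ (#pairs≥ inImage)) ⟩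
    λ₁ * #pairs inImage + 3 * p ^ 5              ∎
    where
    open ≤-Reasoning
    lo : ℕ
    lo = p * n

  module _ (𝒜 : Family) (𝒜≡Loeffler : ∀ q → (𝒜 p q ≡ true) ⇔ LoefflerSet k₁ k₂ p q) where

    cardC≡#pairs : cardC 𝒜 p ≡ #pairs inImage
    cardC≡#pairs = trans (length-filter-allPairs p P)
      (∑ˡ-allMat2 p _ (λ a b c d → ∑⁴ (summand a b c d))
        (λ a b c d → ∑ˡ-allMat2 p _ (summand (toℕ a) (toℕ b) (toℕ c) (toℕ d))
          (λ a′ b′ c′ d′ → pair-term (a , b , c , d) (a′ , b′ , c′ , d′))))
      where
      summand : ℕ → ℕ → ℕ → ℕ → ℕ → ℕ → ℕ → ℕ → ℕ
      summand a b c d a′ b′ c′ d′ = 𝟙 (inImage (detᵣ a b c d) (detᵣ a′ b′ c′ d′)) * δ (trᵣ a d) (trᵣ a′ d′)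
      P : Mat2 p × Mat2 p → Bool
      P q = 𝒜 p q ∧ ⌊ tr (proj₁ q) ≟ tr (proj₂ q) ⌋
      𝒜≡inImage : ∀ A B → 𝒜 p (A , B) ≡ inImage (det A) (det B)
      𝒜≡inImage A B = Bool.⇔→≡ {z = true} (mk⇔
        (λ A,B∈𝒜 → Equivalence.to (LoefflerSet⇔inImage A B) (Equivalence.to (𝒜≡Loeffler (A , B)) A,B∈𝒜))
        (λ det∈ → Equivalence.from (𝒜≡Loeffler (A , B)) (Equivalence.from (LoefflerSet⇔inImage A B) det∈)))
      pair-term : ∀ A B → 𝟙 (P (A , B)) ≡ 𝟙 (inImage (det A) (det B)) * δ (tr A) (tr B)
      pair-term A B =
        trans (𝟙-∧ (𝒜 p (A , B)) _) (cong₂ (λ u v → 𝟙 u * 𝟙 v) (𝒜≡inImage A B) (⌊≟⌋≡≡ᵇ (tr A) (tr B)))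

    cardC-estimate : ℚ.∣ ℕ→ℚ (cardC 𝒜 p) ℚ.- divℕ (ℕ→ℚ (p ^ 6)) λ₁ ∣ ℚ.≤ ℕ→ℚ 3 ℚ.* ℕ→ℚ (p ^ 5)
    cardC-estimate = subst (ℚ.∣ ℕ→ℚ (cardC 𝒜 p) ℚ.- divℕ (ℕ→ℚ (p ^ 6)) λ₁ ∣ ℚ.≤_) (ℕ→ℚ-* 3 (p ^ 5))
      (∣x-a/l∣≤d λ₁ (cardC 𝒜 p) (p ^ 6) (3 * p ^ 5) (gcd[m,n]≢0 n _ (inj₁ n≢0))
        (subst (λ X → λ₁ * X ≤ p ^ 6 + 3 * p ^ 5) (sym cardC≡#pairs)
               (≤-trans λ₁*#pairs≤ (+-monoʳ-≤ (p ^ 6) (m≤n*m (p ^ 5) 3))))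
        (subst (λ X → p ^ 6 ≤ λ₁ * X + 3 * p ^ 5) (sym cardC≡#pairs) p⁶≤λ₁*#pairs+3p⁵))

open import Data.Nat using (_≥_; _^_)
open import Data.Bool using (true)
open import Data.Product using (_×_; _,_; Σ)
open import Relation.Binary.PropositionalEquality using (_≡_)
open import Function.Bundles using (_⇔_)
open import Data.Rational using (ℚ; 0ℚ; _<_; _≤_; _-_; _*_; ∣_∣)
open import Data.Rational.Properties using (positive⁻¹)
open import Defs

lemma3p3 : (k₁ k₂ M : ℕ) → k₁ ≥ 2 → k₂ ≥ 2 → M ≥ 3 →
    (𝒜 : Family) →
    (∀ (ℓ : ℕ) → Prime ℓ → ℓ ≥ M → ∀ (p : Mat2 ℓ × Mat2 ℓ) →
       (𝒜 ℓ p ≡ true) ⇔ LoefflerSet k₁ k₂ ℓ p) →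
    Σ ℚ (λ C → (0ℚ < C) ×
      (∀ (ℓ : ℕ) → Prime ℓ → ℓ ≥ M →
        ∣ ℕ→ℚ (cardC 𝒜 ℓ) - divℕ (ℕ→ℚ (ℓ ^ 6)) (lambda1 ℓ k₁ k₂) ∣
          ≤ C * ℕ→ℚ (ℓ ^ 5)))
lemma3p3 k₁ k₂ M _ _ _ 𝒜 𝒜≡Loeffler = ℕ→ℚ 3 , positive⁻¹ (ℕ→ℚ 3) , estimate
  where
  estimate : ∀ ℓ → Prime ℓ → ℓ ≥ M →
    ∣ ℕ→ℚ (cardC 𝒜 ℓ) - divℕ (ℕ→ℚ (ℓ ^ 6)) (lambda1 ℓ k₁ k₂) ∣ ≤ ℕ→ℚ 3 * ℕ→ℚ (ℓ ^ 5)
  estimate (ℕ.suc n) ℓ-prime ℓ≥M = Estimate.cardC-estimate n ℓ-prime k₁ k₂ 𝒜 (𝒜≡Loeffler (ℕ.suc n) ℓ-prime ℓ≥M)
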